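{- Let $\mathcal{P}$ be a mobile poset with underlying ribbon $\mathcal{Z}=\mathcal{Z}^{(\ell)}_S$, let $F$ be the set of path folds for $\mathcal{P}$, $k=\#F$, with induced path order $\sigma_0,\dots,\sigma_k$. Then for every $0\le i\le j\le k$ the poset $\mathcal{P}_{i,j}$ is a $d$-complete poset.
   Context: $x\lessdot y$ means $y$ covers $x$; a cover relation is recorded as $(x,y)$. Ribbon $\mathcal{Z}^{(\ell)}_S$: poset on $z_1,\dots,z_\ell$ with $z_{i+1}\lessdot z_i$ for $i\in S$ and $z_i\lessdot z_{i+1}$ for $i\in[\ell-1]\setminus S$. $d$-complete posets: for $k\ge3$, $d_k(1)$ consists of a chain $c_1<\dots<c_{k-2}$, two incomparable elements $x,y$ covering $c_{k-2}$, and a chain $n_1<\dots<n_{k-2}$ with $n_1$ covering $x$ and $y$ (the neck). A $d_k$-interval is an interval $[w,z]$ isomorphic to $d_k(1)$; a $d_k^-$-convex set is a convex subset isomorphic to $d_k(1)$ minus its maximum. A poset is $d$-complete if for all $k\ge3$: (1) every $d_k^-$-convex set $I$ has an element $p$ covering its maximal elements with $I\cup\{p\}$ a $d_k$-interval; (2) the top $z$ of a $d_k$-interval $[w,z]$ covers no element outside it; (3) no two $d_k^-$-convex sets differ only in their minimal elements. The top tree of a connected $d$-complete poset is the set of $x$ such that each $y\ge x$ is covered by at most one element; an element is acyclic if it lies in the top tree and in no neck of a $d_k$-interval. Mobile posets: from $\mathcal{Z}$: (i) for each $z\in\mathcal{Z}$ attach $m_z\ge0$ disjoint connected $d$-complete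 posets by making $z$ cover their maximal elements; (ii) optionally, for one $z'=z_j$ (the anchor), attach a disjoint connected $d$-complete poset $\mathcal{Q}$ by adding $z'\lessdot q$ for an acyclic $q\in\mathcal{Q}$; take transitive closures. Free-standing (w.r.t. $\mathcal{Z}$) means (ii) not used. Folds: $\mathcal{P}\ominus F$ has order generated by cover relations not in $F$; $\mathcal{P}_F$ is obtained from it by adding $y<x$ for each $(x,y)\in F$ and taking transitive closure. Path folds: $F=\{(z_{i+1},z_i): i\in S\}$ if free-standing, else $F=\{(z_{i+1},z_i): i\in S,i<j\}\cup\{(z_i,z_{i+1}): i\notin S,i\ge j\}$. The $k+1$ connected components of $\mathcal{P}\ominus F$ each contain a block of consecutive ribbon elements; ordering them by increasing indices gives the induced path order $\sigma_0,\dots,\sigma_k$. $\mathcal{P}_{i,j}$ is the induced subposet of $\mathcal{P}_F$ on $\sigma_i\cup\dots\cup\sigma_j$. -}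

module Defs where

open import Data.Nat using (ℕ; zero; suc; _+_; _<_; _≤_; _<ᵇ_)
open import Data.Fin using (Fin; toℕ; inject₁) renaming (zero to fzero; suc to fsuc)
open import Data.Bool using (Bool; true; false; T; not; _∧_; _∨_; if_then_else_)
open import Data.List using (List; length; lookup)
open import Data.Maybe using (Maybe; just; nothing)
open import Data.Product using (Σ; ∃; _×_; _,_; proj₁)
open import Data.Sum using (_⊎_)
open import Relation.Nullary using (¬_)
open import Data.Empty using (⊥)
open import Relation.Binary.PropositionalEquality using (_≡_)
open import Relation.Binary.Structures using (IsPartialOrder)
open import Relation.Binary.Construct.Closure.ReflexiveTransitive using (Star)

_iff_ : Set → Set → Set
A iff B = (A → B) × (B → A)

-- DK m e : chain c_0 < ... < c_m (m+1 = k-2 elements), two incomparable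
-- elements x, y covering c_m, and a chain nk_0 < ... < nk_(e-1) above them.
-- d_k(1)   = DK m (suc m)   with k = m + 3
-- d_k^-    = DK m m         (d_k(1) minus its maximum)

data DK (m e : ℕ) : Set where
  c  : Fin (suc m) → DK m e
  dx : DK m e
  dy : DK m e
  nk : Fin e → DK m e

rank : ∀ {m e} → DK m e → ℕ
rank (c i) = toℕ i
rank {m} dx = suc m
rank {m} dy = suc m
rank {m} (nk i) = suc (suc m) + toℕ i

-- order: equal, or strictly smaller rank (x and y share a rank, so are incomparable)
_≤DK_ : ∀ {m e} → DK m e → DK m e → Set
a ≤DK b = a ≡ b ⊎ rank a < rank b

module Order {C : Set} (_≈_ : C → C → Set) (_≤_ : C → C → Set) where

  _<ₒ_ : C → C → Set
  a <ₒ b = (a ≤ b) × ¬ (a ≈ b)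

  _⋖_ : C → C → Set
  a ⋖ b = (a <ₒ b) × (∀ d → a <ₒ d → d <ₒ b → ⊥)

  Interval : C → C → C → Set
  Interval w z u = (w ≤ u) × (u ≤ z)

  Convex : (C → Set) → Set
  Convex I = ∀ a b d → I a → I d → a ≤ b → b ≤ d → I b

  MaxIn : (C → Set) → C → Set
  MaxIn I q = I q × (∀ u → I u → q ≤ u → u ≈ q)

  MinIn : (C → Set) → C → Set
  MinIn I q = I q × (∀ u → I u → u ≤ q → u ≈ q)

  IsoOnto : (A : Set) → (A → A → Set) → (C → Set) → Set
  IsoOnto A _≤A_ I =
    Σ (A → C) λ f →
      (∀ a b → f a ≈ f b → a ≡ b) ×
      (∀ u → I u iff (∃ λ a → f a ≈ u)) ×
      (∀ a b → (a ≤A b) iff (f a ≤ f b))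

  -- [w,z] is a d_k-interval, k = m + 3
  DkInterval : ℕ → C → C → Set
  DkInterval m w z = IsoOnto (DK m (suc m)) _≤DK_ (Interval w z)

  -- I is a d_k^- -convex set, k = m + 3
  DkMinusConvex : ℕ → (C → Set) → Set
  DkMinusConvex m I = Convex I × IsoOnto (DK m m) _≤DK_ I

  DComplete : Set₁
  DComplete =
    (∀ m (I : C → Set) → DkMinusConvex m I →
      Σ C λ p → (∀ q → MaxIn I q → q ⋖ p) ×
        Σ C λ w → DkInterval m w p ×
          (∀ u → Interval w p u iff (I u ⊎ u ≈ p))) ×
    (∀ m w z → DkInterval m w z → ∀ u → u ⋖ z → Interval w z u) ×
    (∀ m (I J : C → Set) → DkMinusConvex m I → DkMinusConvex m J →
      (∀ u → (I u × ¬ MinIn I u) iff (J u × ¬ MinIn J u)) →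
      ∀ u → I u iff J u)

  IsDCompletePoset : Set₁
  IsDCompletePoset = IsPartialOrder _≈_ _≤_ × DComplete

  Connected : Set
  Connected = ∀ a b → Star (λ u v → u ≤ v ⊎ v ≤ u) a b

  InTopTree : C → Set
  InTopTree x = ∀ y → x ≤ y → ∀ a b → y ⋖ a → y ⋖ b → a ≈ b

  InNeck : C → Set
  InNeck q = Σ ℕ λ m → Σ C λ w → Σ C λ z → Σ (DkInterval m w z) λ iso →
             ∃ λ (i : Fin (suc m)) → proj₁ iso (nk i) ≈ q

  Acyclic : C → Set
  Acyclic q = InTopTree q × ¬ InNeck q

record CDPoset : Set₁ where
  field
    size   : ℕ
    _≤ₚ_   : Fin size → Fin size → Set
    isPO   : IsPartialOrder _≡_ _≤ₚ_
    conn   : Order.Connected _≡_ _≤ₚ_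
    dcomp  : Order.DComplete _≡_ _≤ₚ_
open CDPoset public

-- optional attachment (ii) of a poset Q above the anchor z_j via z_j ⋖ q
data Anchoring (L : ℕ) : Set₁ where
  free     : Anchoring L
  anchored : (j : Fin (suc L)) (Q : CDPoset) (q : Fin (size Q)) →
             Order.Acyclic _≡_ (_≤ₚ_ Q) q → Anchoring L

-- Mobile poset data. Ribbon Z^(ℓ)_S with ℓ = suc L, elements z_0..z_L
-- (0-indexed), ribbon edge b : Fin L joins z_b and z_(b+1);
-- S b = true means z_(b+1) ⋖ z_b, otherwise z_b ⋖ z_(b+1).
record Mobile : Set₁ where
  field
    L      : ℕ
    S      : Fin L → Bool
    attach : Fin (suc L) → List CDPoset
    anch   : Anchoring L

countT : ∀ {n} → (Fin n → Bool) → ℕ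
countT {zero} f = 0
countT {suc n} f = (if f fzero then 1 else 0) + countT (λ i → f (fsuc i))

module MobileP (M : Mobile) where
  open Mobile M

  qsize : ℕ
  qsize with anch
  ... | free = 0
  ... | anchored j Q q a = size Q

  qLe : Fin qsize → Fin qsize → Set
  qLe with anch
  ... | free = λ _ _ → Bool
  ... | anchored j Q q a = _≤ₚ_ Q

  anchorPt : Maybe (Fin (suc L) × Fin qsize)
  anchorPt with anch
  ... | free = nothing
  ... | anchored j Q q a = just (j , q)

  attP : (z : Fin (suc L)) → Fin (length (attach z)) → CDPoset
  attP z t = lookup (attach z) t

  data Elem : Set where
    rib : Fin (suc L) → Elem
    att : (z : Fin (suc L)) (t : Fin (length (attach z))) → Fin (size (attP z t)) → Elem
    anc : Fin qsize → Elem

  data Gen : Elem → Elem → Set where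
    ribDown : (b : Fin L) → T (S b) → Gen (rib (fsuc b)) (rib (inject₁ b))
    ribUp   : (b : Fin L) → T (not (S b)) → Gen (rib (inject₁ b)) (rib (fsuc b))
    inAtt   : ∀ z t u v → _≤ₚ_ (attP z t) u v → Gen (att z t u) (att z t v)
    attTop  : ∀ z t u → (∀ v → _≤ₚ_ (attP z t) u v → v ≡ u) → Gen (att z t u) (rib z)
    inQ     : ∀ u v → qLe u v → Gen (anc u) (anc v)
    ancEdge : ∀ j q → anchorPt ≡ just (j , q) → Gen (rib j) (anc q)

  _≤P_ : Elem → Elem → Set
  _≤P_ = Star Gen

  open Order {Elem} _≡_ _≤P_ public using () renaming (_⋖_ to _⋖P_)

  -- path folds, as a set of ribbon edges
  folded : Fin L → Bool
  folded b with anch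
  ... | free = S b
  ... | anchored j Q q a =
        (S b ∧ (toℕ b <ᵇ toℕ j)) ∨ (not (S b) ∧ not (toℕ b <ᵇ toℕ j))

  RibCov : Fin L → Elem → Elem → Set
  RibCov b x y = (T (S b) × x ≡ rib (fsuc b) × y ≡ rib (inject₁ b))
               ⊎ (T (not (S b)) × x ≡ rib (inject₁ b) × y ≡ rib (fsuc b))

  -- the set F of path folds, as a relation: F x y  iff  (x , y) ∈ F
  F : Elem → Elem → Set
  F x y = Σ (Fin L) λ b → T (folded b) × RibCov b x y

  k : ℕ
  k = countT folded

  _≤⊖_ : Elem → Elem → Set
  _≤⊖_ = Star (λ a b → (a ⋖P b) × ¬ F a b)

  _≤F_ : Elem → Elem → Set
  _≤F_ = Star (λ a b → ((a ⋖P b) × ¬ F a b) ⊎ F b a)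

  SameComp : Elem → Elem → Set
  SameComp = Star (λ a b → a ≤⊖ b ⊎ b ≤⊖ a)

  -- index of the block (= of σ_t) containing the ribbon element z_a:
  -- number of folded ribbon edges below a
  blk : Fin (suc L) → ℕ
  blk a = countT (λ b → folded b ∧ (toℕ b <ᵇ toℕ a))

  InBlocks : ℕ → ℕ → Elem → Set
  InBlocks i j x = ∃ λ a → (i ≤ blk a) × (blk a ≤ j) × SameComp x (rib a)

  PijCarrier : ℕ → ℕ → Set
  PijCarrier i j = Σ Elem (InBlocks i j)

  _≈ij_ : ∀ {i j} → PijCarrier i j → PijCarrier i j → Set
  p ≈ij q = proj₁ p ≡ proj₁ q

  _≤ij_ : ∀ {i j} → PijCarrier i j → PijCarrier i j → Set
  p ≤ij q = proj₁ p ≤F proj₁ q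

-- In P_F every ribbon edge is oriented towards a root (the anchor z_j, or z_ℓ when the mobile is
-- free-standing), so P_F is a partial order in which each ribbon element is covered by at most one
-- element. The block index is constant along P ⊖ F, so P_{i,j} consists of whole attached posets,
-- ribbon elements and possibly all of Q. A d_k^- set or d_k interval of P_{i,j} contains an element
-- with two upper covers, hence it is not on the ribbon, and it then spreads to lie inside a single
-- attached poset or inside Q: leaving an attached poset means passing its ribbon element, and
-- leaving Q means passing the anchor q, which has a unique upper cover since it is acyclic. Each of
-- the three axioms of d-completeness is thereby inherited from that d-complete poset.

module Submission where

open import Defs
open import Data.Bool using (Bool; true; false; T; not; _∧_; if_then_else_)
open import Data.Bool.Properties using (∧-zeroʳ; ∧-identityʳ)
open import Data.Empty using (⊥; ⊥-elim)
open import Data.Fin using (Fin; toℕ; inject₁; fromℕ; fromℕ<) renaming (zero to fzero; suc to fsuc)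
import Data.Fin.Properties as Fin
open import Data.Fin.Induction using (po-wellFounded; po-noetherian)
open import Data.List using (length)
open import Data.Maybe using (just)
open import Data.Nat using (ℕ; zero; suc; z≤n; s≤s; _+_; _∸_; _≤_; _<_; _<ᵇ_)
import Data.Nat.Properties as ℕ
open import Data.Product
open import Data.Sum
open import Data.Unit using (tt)
open import Function using (_∘_; flip; case_of_)
open import Induction.WellFounded using (Acc; acc)
open import Relation.Nullary
open import Relation.Binary.PropositionalEquality
open import Relation.Binary.Definitions using (Decidable; Transitive)
open import Relation.Binary.Structures using (IsPartialOrder)
open import Relation.Binary.Construct.Closure.ReflexiveTransitive


oneIf : Bool → ℕ
oneIf b = if b then 1 else 0

oneIf-mono : ∀ {x y} → (T x → T y) → oneIf x ≤ oneIf y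
oneIf-mono {false} h = z≤n
oneIf-mono {true} {true} h = ℕ.≤-refl
oneIf-mono {true} {false} h = ⊥-elim (h tt)

countT-mono : ∀ {n} (f g : Fin n → Bool) → (∀ i → T (f i) → T (g i)) → countT f ≤ countT g
countT-mono {zero} f g h = z≤n
countT-mono {suc n} f g h =
  ℕ.+-mono-≤ (oneIf-mono (h fzero)) (countT-mono (f ∘ fsuc) (g ∘ fsuc) (h ∘ fsuc))

countT-allFalse : ∀ {n} (f : Fin n → Bool) → (∀ i → f i ≡ false) → countT f ≡ 0
countT-allFalse {zero} f h = refl
countT-allFalse {suc n} f h rewrite h fzero = countT-allFalse (f ∘ fsuc) (h ∘ fsuc)

countT-below-suc : ∀ {n} (f : Fin n → Bool) (b : Fin n) →
  countT (λ x → f x ∧ (toℕ x <ᵇ suc (toℕ b))) ≡ countT (λ x → f x ∧ (toℕ x <ᵇ toℕ b)) + oneIf (f b)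
countT-below-suc {suc n} f fzero = begin
    oneIf (f fzero ∧ true) + countT (λ i → f (fsuc i) ∧ false)
  ≡⟨ cong₂ _+_ (cong oneIf (∧-identityʳ (f fzero))) noneBelow0 ⟩
    oneIf (f fzero) + 0
  ≡⟨ ℕ.+-comm (oneIf (f fzero)) 0 ⟩
    0 + oneIf (f fzero)
  ≡⟨ cong₂ (λ x k → oneIf x + k + oneIf (f fzero)) (sym (∧-zeroʳ (f fzero))) (sym noneBelow0) ⟩
    oneIf (f fzero ∧ false) + countT (λ i → f (fsuc i) ∧ false) + oneIf (f fzero)
  ∎
  where
  open ≡-Reasoning
  noneBelow0 : countT (λ i → f (fsuc i) ∧ false) ≡ 0
  noneBelow0 = countT-allFalse _ (λ i → ∧-zeroʳ (f (fsuc i)))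
countT-below-suc {suc n} f (fsuc b) =
  trans (cong (oneIf (f fzero ∧ true) +_) (countT-below-suc (f ∘ fsuc) b))
        (sym (ℕ.+-assoc (oneIf (f fzero ∧ true)) _ (oneIf (f (fsuc b)))))

-- The orders of the attached posets are not decidable in general; finiteness only makes
-- decidability (and hence cover chains and maximal elements) available under double negation,
-- which suffices because every fact derived from them is a negation.
¬¬-∀-Fin : ∀ {n} {P : Fin n → Set} → (∀ i → ¬ ¬ P i) → ¬ ¬ (∀ i → P i)
¬¬-∀-Fin {zero} h k = k (λ ())
¬¬-∀-Fin {suc n} {P} h k =
  h fzero λ p0 → ¬¬-∀-Fin {n} {P ∘ fsuc} (h ∘ fsuc) λ ps → k λ { fzero → p0 ; (fsuc i) → ps i }

¬¬-decidable : ∀ {n} (R : Fin n → Fin n → Set) → ¬ ¬ Decidable R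
¬¬-decidable R = ¬¬-∀-Fin (λ a → ¬¬-∀-Fin (λ b → ¬¬-excluded-middle))

module FinitePoset {n : ℕ} {_⊑_ : Fin n → Fin n → Set}
                   (isPO : IsPartialOrder _≡_ _⊑_) (_⊑?_ : Decidable _⊑_) where
  open Order {Fin n} _≡_ _⊑_
  open IsPartialOrder isPO using () renaming (trans to ⊑-trans; refl to ⊑-refl)

  _<?_ : Decidable _<ₒ_
  a <? b = (a ⊑? b) ×-dec ¬? (a Fin.≟ b)

  cover-below : ∀ {u v} → u <ₒ v → ∃ λ d → u ⋖ d × d ⊑ v
  cover-below {u} {v} u<v = go v (po-wellFounded isPO v) u<v
    where
    go : ∀ v → Acc _<ₒ_ v → u <ₒ v → ∃ λ d → u ⋖ d × d ⊑ v
    go v (acc rec) u<v with Fin.any? (λ d → (u <? d) ×-dec (d <? v))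
    ... | yes (d , u<d , d<v) =
      let (d' , u⋖d' , d'⊑d) = go d (rec d<v) u<d in d' , u⋖d' , ⊑-trans d'⊑d (proj₁ d<v)
    ... | no ∄d = v , (u<v , λ d u<d d<v → ∄d (d , u<d , d<v)) , ⊑-refl

  cover-chain : ∀ {u v} → u ⊑ v → Star _⋖_ u v
  cover-chain {u} {v} u⊑v = go u (po-noetherian isPO u) u⊑v
    where
    go : ∀ u → Acc (flip _<ₒ_) u → u ⊑ v → Star _⋖_ u v
    go u (acc rec) u⊑v with u Fin.≟ v
    ... | yes refl = ε
    ... | no u≢v = let (d , u⋖d , d⊑v) = cover-below (u⊑v , u≢v) in u⋖d ◅ go d (rec (proj₁ u⋖d)) d⊑v

  maximal-above : ∀ v → ∃ λ m → v ⊑ m × (∀ d → m ⊑ d → d ≡ m)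
  maximal-above v = go v (po-noetherian isPO v)
    where
    go : ∀ v → Acc (flip _<ₒ_) v → ∃ λ m → v ⊑ m × (∀ d → m ⊑ d → d ≡ m)
    go v (acc rec) with Fin.any? (v <?_)
    ... | yes (d , v<d) = let (m , d⊑m , max) = go d (rec v<d) in m , ⊑-trans (proj₁ v<d) d⊑m , max
    ... | no ∄d = v , ⊑-refl , λ d v⊑d → decidable-stable (d Fin.≟ v) (λ d≢v → ∄d (d , v⊑d , d≢v ∘ sym))


interval-convex : {C : Set} (_≈_ : C → C → Set) {_≤_ : C → C → Set} → Transitive _≤_ →
                  ∀ w z → Order.Convex _≈_ _≤_ (Order.Interval _≈_ _≤_ w z)
interval-convex _≈_ ≤-trans w z a b d (w≤a , _) (_ , d≤z) a≤b b≤d = ≤-trans w≤a a≤b , ≤-trans b≤d d≤z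

-- The posets d_k(1)

module _ {m e : ℕ} where
  open Order {DK m e} _≡_ _≤DK_

  _≟DK_ : (a b : DK m e) → Dec (a ≡ b)
  c i ≟DK c j with i Fin.≟ j
  ... | yes refl = yes refl
  ... | no i≢j = no (λ { refl → i≢j refl })
  c i ≟DK dx = no (λ ())
  c i ≟DK dy = no (λ ())
  c i ≟DK nk j = no (λ ())
  dx ≟DK c j = no (λ ())
  dx ≟DK dx = yes refl
  dx ≟DK dy = no (λ ())
  dx ≟DK nk j = no (λ ())
  dy ≟DK c j = no (λ ())
  dy ≟DK dx = no (λ ())
  dy ≟DK dy = yes refl
  dy ≟DK nk j = no (λ ())
  nk i ≟DK c j = no (λ ())
  nk i ≟DK dx = no (λ ())
  nk i ≟DK dy = no (λ ())
  nk i ≟DK nk j with i Fin.≟ j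
  ... | yes refl = yes refl
  ... | no i≢j = no (λ { refl → i≢j refl })

  _≤DK?_ : Decidable (_≤DK_ {m} {e})
  a ≤DK? b = (a ≟DK b) ⊎-dec (rank a ℕ.<? rank b)

  any-DK : (P : DK m e → Set) → (∀ a → Dec (P a)) → Dec (∃ P)
  any-DK P P? with Fin.any? (P? ∘ c) | P? dx | P? dy | Fin.any? (P? ∘ nk)
  ... | yes (i , p) | _ | _ | _ = yes (c i , p)
  ... | no _ | yes p | _ | _ = yes (dx , p)
  ... | no _ | no _ | yes p | _ = yes (dy , p)
  ... | no _ | no _ | no _ | yes (i , p) = yes (nk i , p)
  ... | no ¬c | no ¬x | no ¬y | no ¬n =
    no λ { (c i , p) → ¬c (i , p) ; (dx , p) → ¬x p ; (dy , p) → ¬y p ; (nk i , p) → ¬n (i , p) }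

  rank-nk≥ : (i : Fin e) → suc (suc m) ≤ rank {m} {e} (nk i)
  rank-nk≥ i = ℕ.m≤m+n _ _

  c0-≤DK : (a : DK m e) → c fzero ≤DK a
  c0-≤DK (c fzero) = inj₁ refl
  c0-≤DK (c (fsuc i)) = inj₂ (s≤s z≤n)
  c0-≤DK dx = inj₂ (s≤s z≤n)
  c0-≤DK dy = inj₂ (s≤s z≤n)
  c0-≤DK (nk i) = inj₂ (s≤s z≤n)

  <ₒ⇒rank< : {a b : DK m e} → a <ₒ b → rank a < rank b
  <ₒ⇒rank< (inj₁ a≡b , a≢b) = ⊥-elim (a≢b a≡b)
  <ₒ⇒rank< (inj₂ lt , _) = lt

  rank-suc⇒⋖ : (a b : DK m e) → suc (rank a) ≡ rank b → a ⋖ b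
  rank-suc⇒⋖ a b eq = (inj₂ a<b , λ { refl → ℕ.<-irrefl refl a<b }) ,
    λ d a<d d<b → ℕ.<⇒≱ (<ₒ⇒rank< d<b) (subst (_≤ rank d) eq (<ₒ⇒rank< a<d))
    where
    a<b : rank a < rank b
    a<b = subst (rank a <_) eq (ℕ.n<1+n (rank a))

  rank≤⇒≤DK : (a b : DK m e) → rank a ≤ rank b → (rank a ≡ rank b → a ≡ b) → a ≤DK b
  rank≤⇒≤DK a b le h with ℕ.m≤n⇒m<n∨m≡n le
  ... | inj₁ lt = inj₂ lt
  ... | inj₂ eq = inj₁ (h eq)

  NextTowards : DK m e → DK m e → Set
  NextTowards a b = ∃ λ a' → suc (rank a) ≡ rank a' × a' ≤DK b

  next-from-c : ∀ i b → toℕ i < rank b → NextTowards (c i) b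
  next-from-c i b lt with toℕ i ℕ.<? m
  ... | yes i<m = c i' , sym rank-i' , rank≤⇒≤DK (c i') b (subst (_≤ rank b) (sym rank-i') lt) (same-rank b)
    where
    i' : Fin (suc m)
    i' = fromℕ< (s≤s i<m)
    rank-i' : toℕ i' ≡ suc (toℕ i)
    rank-i' = Fin.toℕ-fromℕ< (s≤s i<m)
    same-rank : ∀ b → rank {m} {e} (c i') ≡ rank b → c i' ≡ b
    same-rank (c j) eq = cong c (Fin.toℕ-injective eq)
    same-rank dx eq = ⊥-elim (ℕ.<-irrefl (trans (sym rank-i') eq) (s≤s i<m))
    same-rank dy eq = ⊥-elim (ℕ.<-irrefl (trans (sym rank-i') eq) (s≤s i<m))
    same-rank (nk j) eq =
      ⊥-elim (ℕ.<-irrefl (trans (sym rank-i') eq) (ℕ.≤-trans (s≤s i<m) (ℕ.≤-trans (ℕ.n≤1+n _) (rank-nk≥ j))))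
  ... | no i≮m = middle b , trans (cong suc i≡m) (rank-middle b) , middle-≤DK b lt
    where
    i≡m : toℕ i ≡ m
    i≡m = ℕ.≤-antisym (Fin.toℕ≤pred[n] i) (ℕ.≮⇒≥ i≮m)
    middle : DK m e → DK m e
    middle dy = dy
    middle _ = dx
    rank-middle : ∀ b → suc m ≡ rank (middle b)
    rank-middle (c _) = refl
    rank-middle dx = refl
    rank-middle dy = refl
    rank-middle (nk _) = refl
    middle-≤DK : ∀ b → toℕ i < rank b → middle b ≤DK b
    middle-≤DK (c j) lt = ⊥-elim (ℕ.<⇒≱ lt (subst (toℕ j ≤_) (sym i≡m) (Fin.toℕ≤pred[n] j)))
    middle-≤DK dx lt = inj₁ refl
    middle-≤DK dy lt = inj₁ refl
    middle-≤DK (nk j) lt = inj₂ (s≤s (s≤s (ℕ.m≤m+n m (toℕ j))))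

  next-from-nk : ∀ i j → rank {m} {e} (nk i) < rank (nk j) → NextTowards (nk i) (nk j)
  next-from-nk i j lt = nk i' , rank-i' , rank≤⇒≤DK (nk i') (nk j) i'≤j same-rank
    where
    i<j : toℕ i < toℕ j
    i<j = ℕ.+-cancelˡ-< (suc (suc m)) (toℕ i) (toℕ j) lt
    si<e : suc (toℕ i) < e
    si<e = ℕ.≤-<-trans i<j (Fin.toℕ<n j)
    i' : Fin e
    i' = fromℕ< si<e
    rank-i' : suc (rank {m} {e} (nk i)) ≡ rank {m} {e} (nk i')
    rank-i' = trans (sym (ℕ.+-suc (suc (suc m)) (toℕ i))) (cong (suc (suc m) +_) (sym (Fin.toℕ-fromℕ< si<e)))
    i'≤j : rank (nk {m} i') ≤ rank (nk {m} j)
    i'≤j = ℕ.+-monoʳ-≤ (suc (suc m)) (subst (_≤ toℕ j) (sym (Fin.toℕ-fromℕ< si<e)) i<j)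
    same-rank : rank (nk {m} i') ≡ rank (nk {m} j) → nk i' ≡ nk j
    same-rank eq = cong nk (Fin.toℕ-injective (ℕ.+-cancelˡ-≡ (suc (suc m)) _ _ eq))

  next-towards : (a b : DK m e) → rank a < rank b → NextTowards a b
  next-towards (c i) b lt = next-from-c i b lt
  next-towards (nk i) (nk j) lt = next-from-nk i j lt
  next-towards dx (nk fzero) lt = nk fzero , sym (ℕ.+-identityʳ _) , inj₁ refl
  next-towards dy (nk fzero) lt = nk fzero , sym (ℕ.+-identityʳ _) , inj₁ refl
  next-towards dx (nk (fsuc j)) lt = nk fzero , sym (ℕ.+-identityʳ _) , inj₂ (ℕ.+-monoʳ-< (suc (suc m)) (s≤s z≤n))
  next-towards dy (nk (fsuc j)) lt = nk fzero , sym (ℕ.+-identityʳ _) , inj₂ (ℕ.+-monoʳ-< (suc (suc m)) (s≤s z≤n))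
  next-towards dx (c j) lt = ⊥-elim (ℕ.<⇒≱ lt (ℕ.≤-trans (Fin.toℕ≤pred[n] j) (ℕ.n≤1+n _)))
  next-towards dy (c j) lt = ⊥-elim (ℕ.<⇒≱ lt (ℕ.≤-trans (Fin.toℕ≤pred[n] j) (ℕ.n≤1+n _)))
  next-towards (nk i) (c j) lt =
    ⊥-elim (ℕ.<⇒≱ lt (ℕ.≤-trans (Fin.toℕ≤pred[n] j) (ℕ.≤-trans (ℕ.n≤1+n _) (ℕ.≤-trans (ℕ.n≤1+n _) (rank-nk≥ i)))))
  next-towards (nk i) dx lt = ⊥-elim (ℕ.<⇒≱ lt (ℕ.≤-trans (ℕ.n≤1+n _) (rank-nk≥ i)))
  next-towards (nk i) dy lt = ⊥-elim (ℕ.<⇒≱ lt (ℕ.≤-trans (ℕ.n≤1+n _) (rank-nk≥ i)))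
  next-towards dx dx lt = ⊥-elim (ℕ.<-irrefl refl lt)
  next-towards dx dy lt = ⊥-elim (ℕ.<-irrefl refl lt)
  next-towards dy dx lt = ⊥-elim (ℕ.<-irrefl refl lt)
  next-towards dy dy lt = ⊥-elim (ℕ.<-irrefl refl lt)

  ≤DK⇒cover-chain : (a b : DK m e) → a ≤DK b → Star _⋖_ a b
  ≤DK⇒cover-chain a b a≤b = go (rank b) a a≤b (ℕ.m≤m+n (rank b) (rank a))
    where
    go : ∀ k a → a ≤DK b → rank b ≤ k + rank a → Star _⋖_ a b
    go k a (inj₁ refl) _ = ε
    go zero a (inj₂ lt) bound = ⊥-elim (ℕ.<⇒≱ lt bound)
    go (suc k) a (inj₂ lt) bound =
      let (a' , eq , a'≤b) = next-towards a b lt in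
      rank-suc⇒⋖ a a' eq ◅ go k a' a'≤b (subst (rank b ≤_) (trans (sym (ℕ.+-suc k (rank a))) (cong (k +_) eq)) bound)

dkTop : ∀ {m} → DK m (suc m)
dkTop {m} = nk (fromℕ m)

≤DK-dkTop : ∀ {m} (a : DK m (suc m)) → a ≤DK dkTop
≤DK-dkTop {m} (c i) = inj₂ (ℕ.≤-trans (s≤s (Fin.toℕ≤pred[n] i)) (ℕ.≤-trans (ℕ.n≤1+n _) (ℕ.m≤m+n _ _)))
≤DK-dkTop {m} dx = inj₂ (ℕ.m≤m+n _ _)
≤DK-dkTop {m} dy = inj₂ (ℕ.m≤m+n _ _)
≤DK-dkTop {m} (nk i) with toℕ i ℕ.≟ m
... | yes i≡m = inj₁ (cong nk (Fin.toℕ-injective (trans i≡m (sym (Fin.toℕ-fromℕ m)))))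
... | no i≢m = inj₂ (ℕ.+-monoʳ-< (suc (suc m))
                (subst (toℕ i <_) (sym (Fin.toℕ-fromℕ m)) (ℕ.≤∧≢⇒< (Fin.toℕ≤pred[n] i) i≢m)))

-- For s = 0 the poset DK 0 0 has the two maximal elements dx and dy; dx is the chosen one.
dk⁻Top : ∀ {s} → DK s s
dk⁻Top {zero} = dx
dk⁻Top {suc s} = nk (fromℕ s)

dk⁻Top-maximal : ∀ {s} (b : DK s s) → dk⁻Top ≤DK b → b ≡ dk⁻Top
dk⁻Top-maximal {zero} dx _ = refl
dk⁻Top-maximal {zero} (c i) (inj₂ lt) = ⊥-elim (ℕ.<⇒≱ lt (ℕ.≤-trans (Fin.toℕ≤pred[n] i) z≤n))
dk⁻Top-maximal {zero} dy (inj₂ lt) = ⊥-elim (ℕ.<-irrefl refl lt)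
dk⁻Top-maximal {suc s} b (inj₁ eq) = sym eq
dk⁻Top-maximal {suc s} (c i) (inj₂ lt) =
  ⊥-elim (ℕ.<⇒≱ lt (ℕ.≤-trans (Fin.toℕ≤pred[n] i) (ℕ.≤-trans (ℕ.n≤1+n _) (ℕ.≤-trans (ℕ.n≤1+n _) (ℕ.m≤m+n _ _)))))
dk⁻Top-maximal {suc s} dx (inj₂ lt) = ⊥-elim (ℕ.<⇒≱ lt (ℕ.≤-trans (ℕ.n≤1+n _) (ℕ.m≤m+n _ _)))
dk⁻Top-maximal {suc s} dy (inj₂ lt) = ⊥-elim (ℕ.<⇒≱ lt (ℕ.≤-trans (ℕ.n≤1+n _) (ℕ.m≤m+n _ _)))
dk⁻Top-maximal {suc s} (nk i) (inj₂ lt) = ⊥-elim (ℕ.<⇒≱ lt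
  (ℕ.+-monoʳ-≤ (suc (suc (suc s))) (subst (toℕ i ≤_) (sym (Fin.toℕ-fromℕ s)) (Fin.toℕ≤pred[n] i))))

rank-dk⁻Top : ∀ s → rank (dk⁻Top {s}) ≡ suc (s + s)
rank-dk⁻Top zero = refl
rank-dk⁻Top (suc s) =
  trans (cong (suc (suc (suc s)) +_) (Fin.toℕ-fromℕ s)) (cong (λ x → suc (suc x)) (sym (ℕ.+-suc s s)))

module _ {s e : ℕ} where

  cTop : DK s e
  cTop = c (fromℕ s)

  cTop⋖ : (x : DK s e) → rank x ≡ suc s → Order._⋖_ _≡_ _≤DK_ cTop x
  cTop⋖ x eq = rank-suc⇒⋖ cTop x (trans (cong suc (Fin.toℕ-fromℕ s)) (sym eq))

  cTop-comparable : (a : DK s e) → (cTop ≤DK a) ⊎ (a ≤DK cTop)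
  cTop-comparable (c j) =
    inj₂ (rank≤⇒≤DK (c j) cTop (subst (toℕ j ≤_) (sym (Fin.toℕ-fromℕ s)) (Fin.toℕ≤pred[n] j)) (cong c ∘ Fin.toℕ-injective))
  cTop-comparable dx = inj₁ (inj₂ (s≤s (ℕ.≤-reflexive (Fin.toℕ-fromℕ s))))
  cTop-comparable dy = inj₁ (inj₂ (s≤s (ℕ.≤-reflexive (Fin.toℕ-fromℕ s))))
  cTop-comparable (nk i) =
    inj₁ (inj₂ (s≤s (ℕ.≤-trans (ℕ.≤-reflexive (Fin.toℕ-fromℕ s)) (ℕ.≤-trans (ℕ.n≤1+n s) (s≤s (ℕ.m≤m+n s (toℕ i)))))))

  c≤DK-cTop : (j : Fin (suc s)) → c j ≤DK cTop
  c≤DK-cTop j = rank≤⇒≤DK (c j) cTop (subst (toℕ j ≤_) (sym (Fin.toℕ-fromℕ s)) (Fin.toℕ≤pred[n] j)) (cong c ∘ Fin.toℕ-injective)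

-- The copy of d_(s+3)^- inside DK m e whose neck is the lowest s neck elements.
module Restriction {m e s : ℕ} (s≤m : s ≤ m) (s≤e : s ≤ e) where
  d : ℕ
  d = m ∸ s

  s+d : s + d ≡ m
  s+d = ℕ.m+[n∸m]≡n s≤m

  c-bound : (i : Fin (suc s)) → toℕ i + d < suc m
  c-bound i = s≤s (subst (toℕ i + d ≤_) s+d (ℕ.+-monoˡ-≤ d (Fin.toℕ≤pred[n] i)))

  nk-bound : (i : Fin s) → toℕ i < e
  nk-bound i = ℕ.<-≤-trans (Fin.toℕ<n i) s≤e

  restrict : DK s s → DK m e
  restrict (c i) = c (fromℕ< (c-bound i))
  restrict dx = dx
  restrict dy = dy
  restrict (nk i) = nk (fromℕ< (nk-bound i))

  rank-restrict : ∀ a → rank (restrict a) ≡ rank a + d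
  rank-restrict (c i) = Fin.toℕ-fromℕ< (c-bound i)
  rank-restrict dx = cong suc (sym s+d)
  rank-restrict dy = cong suc (sym s+d)
  rank-restrict (nk i) = begin
      suc (suc m) + toℕ (fromℕ< (nk-bound i))
    ≡⟨ cong (suc (suc m) +_) (Fin.toℕ-fromℕ< (nk-bound i)) ⟩
      suc (suc m) + toℕ i
    ≡⟨ cong (λ x → suc (suc x) + toℕ i) (sym s+d) ⟩
      suc (suc (s + d)) + toℕ i
    ≡⟨ cong (λ x → suc (suc x)) (ℕ.+-assoc s d (toℕ i)) ⟩
      suc (suc (s + (d + toℕ i)))
    ≡⟨ cong (λ x → suc (suc (s + x))) (ℕ.+-comm d (toℕ i)) ⟩
      suc (suc (s + (toℕ i + d)))
    ≡⟨ cong (λ x → suc (suc x)) (sym (ℕ.+-assoc s (toℕ i) d)) ⟩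
      suc (suc (s + toℕ i + d))
    ∎
    where open ≡-Reasoning

  restrict-injective : ∀ a b → restrict a ≡ restrict b → a ≡ b
  restrict-injective (c i) (c j) eq = cong c (Fin.toℕ-injective (ℕ.+-cancelʳ-≡ d (toℕ i) (toℕ j)
      (trans (sym (Fin.toℕ-fromℕ< (c-bound i)))
             (trans (cong (λ { (c x) → toℕ x ; _ → 0 }) eq) (Fin.toℕ-fromℕ< (c-bound j))))))
  restrict-injective dx dx eq = refl
  restrict-injective dy dy eq = refl
  restrict-injective (nk i) (nk j) eq = cong nk (Fin.toℕ-injective
      (trans (sym (Fin.toℕ-fromℕ< (nk-bound i)))
             (trans (cong (λ { (nk x) → toℕ x ; _ → 0 }) eq) (Fin.toℕ-fromℕ< (nk-bound j)))))
  restrict-injective (c i) dx ()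
  restrict-injective (c i) dy ()
  restrict-injective (c i) (nk j) ()
  restrict-injective dx (c j) ()
  restrict-injective dx dy ()
  restrict-injective dx (nk j) ()
  restrict-injective dy (c j) ()
  restrict-injective dy dx ()
  restrict-injective dy (nk j) ()
  restrict-injective (nk i) (c j) ()
  restrict-injective (nk i) dx ()
  restrict-injective (nk i) dy ()

  restrict-mono : ∀ a b → a ≤DK b → restrict a ≤DK restrict b
  restrict-mono a b (inj₁ refl) = inj₁ refl
  restrict-mono a b (inj₂ lt) =
    inj₂ (subst₂ _<_ (sym (rank-restrict a)) (sym (rank-restrict b)) (ℕ.+-monoˡ-< d lt))

  restrict-reflects : ∀ a b → restrict a ≤DK restrict b → a ≤DK b
  restrict-reflects a b (inj₁ eq) = inj₁ (restrict-injective a b eq)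
  restrict-reflects a b (inj₂ lt) =
    inj₂ (ℕ.+-cancelʳ-< d (rank a) (rank b) (subst₂ _<_ (rank-restrict a) (rank-restrict b) lt))

  rank≤-or-nk : (a : DK s s) → rank a ≤ suc s ⊎ ∃ λ j → a ≡ nk j
  rank≤-or-nk (c i) = inj₁ (ℕ.≤-trans (Fin.toℕ≤pred[n] i) (ℕ.n≤1+n s))
  rank≤-or-nk dx = inj₁ ℕ.≤-refl
  rank≤-or-nk dy = inj₁ ℕ.≤-refl
  rank≤-or-nk (nk j) = inj₂ (j , refl)

  restrict-convex : ∀ α β δ → restrict α ≤DK β → β ≤DK restrict δ → ∃ λ γ → restrict γ ≡ β
  restrict-convex α β δ (inj₁ eq) _ = α , eq
  restrict-convex α β δ (inj₂ _) (inj₁ eq) = δ , sym eq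
  restrict-convex α dx δ (inj₂ _) (inj₂ _) = dx , refl
  restrict-convex α dy δ (inj₂ _) (inj₂ _) = dy , refl
  restrict-convex α (c j) δ (inj₂ α<j) (inj₂ _) = c γ , cong c (Fin.toℕ-injective restrict-γ)
    where
    d≤j : d ≤ toℕ j
    d≤j = ℕ.≤-trans (ℕ.m≤n+m d (rank α)) (ℕ.≤-trans (ℕ.≤-reflexive (sym (rank-restrict α))) (ℕ.<⇒≤ α<j))
    γ-bound : toℕ j ∸ d < suc s
    γ-bound = s≤s (subst (toℕ j ∸ d ≤_) (trans (cong (_∸ d) (sym s+d)) (ℕ.m+n∸n≡m s d))
                         (ℕ.∸-monoˡ-≤ d (Fin.toℕ≤pred[n] j)))
    γ : Fin (suc s)
    γ = fromℕ< γ-bound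
    restrict-γ : toℕ (fromℕ< (c-bound γ)) ≡ toℕ j
    restrict-γ = trans (Fin.toℕ-fromℕ< (c-bound γ)) (trans (cong (_+ d) (Fin.toℕ-fromℕ< γ-bound)) (ℕ.m∸n+n≡m d≤j))
  restrict-convex α (nk j) δ (inj₂ _) (inj₂ j<δ) with rank≤-or-nk δ
  ... | inj₁ δ-low = ⊥-elim (ℕ.<⇒≱ j<δ (subst (_≤ rank (nk {m} {e} j)) (sym (rank-restrict δ))
          (ℕ.≤-trans (ℕ.+-monoˡ-≤ d δ-low)
                     (subst (_≤ suc (suc m) + toℕ j) (cong suc (sym s+d)) (ℕ.≤-trans (ℕ.n≤1+n _) (rank-nk≥ j))))))
  ... | inj₂ (j' , refl) = nk γ , cong nk (Fin.toℕ-injective (trans (Fin.toℕ-fromℕ< (nk-bound γ)) (Fin.toℕ-fromℕ< j<s)))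
    where
    j<j' : suc (suc m) + toℕ j < suc (suc m) + toℕ j'
    j<j' = subst (suc (suc m) + toℕ j <_) (cong (suc (suc m) +_) (Fin.toℕ-fromℕ< (nk-bound j'))) j<δ
    j<s : toℕ j < s
    j<s = ℕ.<-trans (ℕ.+-cancelˡ-< (suc (suc m)) (toℕ j) (toℕ j') j<j') (Fin.toℕ<n j')
    γ : Fin s
    γ = fromℕ< j<s


-- Transferring d-completeness from an embedded piece

module DKCopies {Y : Set} (_≈_ : Y → Y → Set) (_≼_ : Y → Y → Set) (poY : IsPartialOrder _≈_ _≼_) where
  open Order _≈_ _≼_
  open IsPartialOrder poY using (module Eq; ≲-respˡ-≈; ≲-respʳ-≈)

  Image : ∀ {s e'} → (DK s e' → Y) → Y → Set
  Image f u = ∃ λ a → f a ≈ u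

  record IsDKEmbedding {s e'} (f : DK s e' → Y) : Set where
    field
      injective : ∀ a b → f a ≈ f b → a ≡ b
      order-iff : ∀ a b → (a ≤DK b) iff (f a ≼ f b)
  open IsDKEmbedding public

  isoOnto⇒embedding : ∀ {s e'} (I : Y → Set) → IsoOnto (DK s e') _≤DK_ I →
                      Σ (DK s e' → Y) λ f → IsDKEmbedding f × (∀ u → I u iff Image f u)
  isoOnto⇒embedding I (f , injective , im , order-iff) = f , record { injective = injective ; order-iff = order-iff } , im

  embedding⇒isoOnto : ∀ {s e'} (I : Y → Set) (f : DK s e' → Y) → IsDKEmbedding f → (∀ u → I u iff Image f u) →
                      IsoOnto (DK s e') _≤DK_ I
  embedding⇒isoOnto I f E im = f , injective E , im , order-iff E

  image-convex : ∀ {s e'} (I : Y → Set) (f : DK s e' → Y) → (∀ u → I u iff Image f u) → Convex I → Convex (Image f)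
  image-convex I f im cv a b d ia id ab bd = proj₁ (im b) (cv a b d (proj₂ (im a) ia) (proj₂ (im d) id) ab bd)

  embedding-preserves-⋖ : ∀ {s e'} (f : DK s e' → Y) → IsDKEmbedding f → Convex (Image f) →
           ∀ a b → Order._⋖_ _≡_ _≤DK_ a b → f a ⋖ f b
  embedding-preserves-⋖ f E cv a b ((ab , nab) , nb) =
    (proj₁ (order-iff E a b) ab , λ eq → nab (injective E a b eq)) ,
    λ d (ad , nad) (db , ndb) →
      let (δ , fδ) = cv (f a) d (f b) (a , Eq.refl) (b , Eq.refl) ad db in
      nb δ (proj₂ (order-iff E a δ) (≲-respʳ-≈ (Eq.sym fδ) ad) , λ eq → nad (subst (λ z → f z ≈ d) (sym eq) fδ))
           (proj₂ (order-iff E δ b) (≲-respˡ-≈ (Eq.sym fδ) db) , λ eq → ndb (subst (λ z → d ≈ f z) eq (Eq.sym fδ)))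

  module _ {m e s} (s≤m : s ≤ m) (s≤e : s ≤ e) {f : DK m e → Y} (fE : IsDKEmbedding f) where
    open Restriction s≤m s≤e

    restrict-embedding : IsDKEmbedding (f ∘ restrict)
    restrict-embedding = record
      { injective = λ a b eq → restrict-injective a b (injective fE _ _ eq)
      ; order-iff = λ a b → (λ a≤b → proj₁ (order-iff fE _ _) (restrict-mono a b a≤b)) ,
                            (λ fa≤fb → restrict-reflects a b (proj₂ (order-iff fE _ _) fa≤fb)) }

    restrict-image-convex : Convex (Image f) → Convex (Image (f ∘ restrict))
    restrict-image-convex f-convex U X V (α , fα≈U) (δ , fδ≈V) U≤X X≤V =
      let (β , fβ≈X) = f-convex U X V (restrict α , fα≈U) (restrict δ , fδ≈V) U≤X X≤V
          α≤β = proj₂ (order-iff fE (restrict α) β) (≲-respˡ-≈ (Eq.sym fα≈U) (≲-respʳ-≈ (Eq.sym fβ≈X) U≤X))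
          β≤δ = proj₂ (order-iff fE β (restrict δ)) (≲-respˡ-≈ (Eq.sym fβ≈X) (≲-respʳ-≈ (Eq.sym fδ≈V) X≤V))
          (γ , restrict-γ≡β) = restrict-convex α β δ α≤β β≤δ
      in γ , subst (λ b → f b ≈ X) (sym restrict-γ≡β) fβ≈X

module Induced (X : Set) (_≤X_ : X → X → Set) (poX : IsPartialOrder _≡_ _≤X_) (Mem : X → Set) where
  open IsPartialOrder poX using () renaming (trans to Xtrans; refl to Xrefl; antisym to Xantisym)

  C : Set
  C = Σ X Mem

  _≈C_ : C → C → Set
  p ≈C q = proj₁ p ≡ proj₁ q

  _≤C_ : C → C → Set
  p ≤C q = proj₁ p ≤X proj₁ q

  isPartialOrder-C : IsPartialOrder _≈C_ _≤C_
  isPartialOrder-C = record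
    { isPreorder = record
      { isEquivalence = record { refl = refl ; sym = sym ; trans = trans }
      ; reflexive = λ {p} {q} eq → subst (λ z → proj₁ p ≤X z) eq Xrefl
      ; trans = Xtrans }
    ; antisym = Xantisym }

  module OC = Order _≈C_ _≤C_
  module GC = DKCopies _≈C_ _≤C_ isPartialOrder-C

  CoverCompletion : ∀ {s} → (C → Set) → Set
  CoverCompletion {s} I = Σ C λ p → (∀ q → OC.MaxIn I q → q OC.⋖ p) × Σ C λ w → OC.DkInterval s w p ×
                            (∀ u → OC.Interval w p u iff (I u ⊎ u ≈C p))

  record Piece : Set₁ where
    field
      n : ℕ
      _⊑_ : Fin n → Fin n → Set
      po : IsPartialOrder _≡_ _⊑_
      dc : Order.DComplete _≡_ _⊑_
      pconn : Order.Connected _≡_ _⊑_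
      ι : Fin n → X
      ι-injective : ∀ {a b} → ι a ≡ ι b → a ≡ b
      ι-reflects : ∀ {a b} → ι a ≤X ι b → a ⊑ b
      -- only covers are assumed preserved; monotonicity then holds under ¬¬ (¬¬ι-mono)
      ι-⋖ : ∀ {a b} → Order._⋖_ _≡_ _⊑_ a b → ι a ≤X ι b
      ι-convex : ∀ {a b x} → ι a ≤X x → x ≤X ι b → Σ (Fin n) λ c → x ≡ ι c
      memUp : ∀ {a b} → Order._⋖_ _≡_ _⊑_ a b → Mem (ι a) → Mem (ι b)
      memDown : ∀ {a b} → Order._⋖_ _≡_ _⊑_ a b → Mem (ι b) → Mem (ι a)

  module Transfer (π : Piece) where
    open Piece π
    module OP = Order {Fin n} _≡_ _⊑_
    module GP = DKCopies {Fin n} _≡_ _⊑_ po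
    open IsPartialOrder po using () renaming (trans to Ptrans; refl to Prefl)

    ι-chain : ∀ {a b} → Star OP._⋖_ a b → ι a ≤X ι b
    ι-chain ε = Xrefl
    ι-chain (cv ◅ cvs) = Xtrans (ι-⋖ cv) (ι-chain cvs)

    memUp* : ∀ {a b} → Star OP._⋖_ a b → Mem (ι a) → Mem (ι b)
    memUp* ε m = m
    memUp* (cv ◅ cvs) m = memUp* cvs (memUp cv m)

    memDown* : ∀ {a b} → Star OP._⋖_ a b → Mem (ι b) → Mem (ι a)
    memDown* ε m = m
    memDown* (cv ◅ cvs) m = memDown cv (memDown* cvs m)

    ¬¬ι-mono : ∀ {a b} → a ⊑ b → ¬ ¬ (ι a ≤X ι b)
    ¬¬ι-mono ab = ¬¬-map (λ dec → ι-chain (FinitePoset.cover-chain po dec ab)) (¬¬-decidable _⊑_)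

    ¬¬mem : ∀ {a b} → Mem (ι a) → ¬ ¬ (Mem (ι b))
    ¬¬mem {a} {b} ma = ¬¬-map (λ dec → go dec (pconn a b) ma) (¬¬-decidable _⊑_)
      where
      go : (∀ a b → Dec (a ⊑ b)) → ∀ {a b} → Star (λ u v → u ⊑ v ⊎ v ⊑ u) a b → Mem (ι a) → Mem (ι b)
      go dec ε m = m
      go dec (inj₁ uv ◅ r) m = go dec r (memUp* (FinitePoset.cover-chain po dec uv) m)
      go dec (inj₂ vu ◅ r) m = go dec r (memDown* (FinitePoset.cover-chain po dec vu) m)

    ⋖C⇒⋖ : ∀ (X Y : C) a b → proj₁ X ≡ ι a → proj₁ Y ≡ ι b → X OC.⋖ Y → a OP.⋖ b
    ⋖C⇒⋖ (x0 , mx) (y0 , my) a b refl refl ((le , ne) , nb) =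
      (ι-reflects le , λ eq → ne (cong ι eq)) ,
      λ d (ad , nad) (db , ndb) → ¬¬ι-mono ad λ l1 → ¬¬ι-mono db λ l2 → ¬¬mem {a} {d} mx λ md →
        nb (ι d , md) (l1 , λ eq → nad (ι-injective eq)) (l2 , λ eq → ndb (ι-injective eq))

    module Pullback {s e'} (g : DK s e' → C) (gE : GC.IsDKEmbedding g) (gConv : OC.Convex (GC.Image g))
              (inP : ∀ a → Σ (Fin n) λ c → proj₁ (g a) ≡ ι c) where
      g' : DK s e' → Fin n
      g' a = proj₁ (inP a)

      ι-g' : ∀ a → ι (g' a) ≡ proj₁ (g a)
      ι-g' a = sym (proj₂ (inP a))

      mem-g' : ∀ a → Mem (ι (g' a))
      mem-g' a = subst Mem (sym (ι-g' a)) (proj₂ (g a))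

      g'-reflects : ∀ a b → g' a ⊑ g' b → a ≤DK b
      g'-reflects a b h with a ≤DK? b
      ... | yes p = p
      ... | no np = ⊥-elim (¬¬ι-mono h λ le → np (proj₂ (GC.order-iff gE a b) (subst₂ _≤X_ (ι-g' a) (ι-g' b) le)))

      g'-mono : ∀ a b → a ≤DK b → g' a ⊑ g' b
      g'-mono a b ab = ι-reflects (subst₂ _≤X_ (sym (ι-g' a)) (sym (ι-g' b)) (proj₁ (GC.order-iff gE a b) ab))

      g'-embedding : GP.IsDKEmbedding g'
      g'-embedding = record
        { injective = λ a b eq → GC.injective gE a b (trans (sym (ι-g' a)) (trans (cong ι eq) (ι-g' b)))
        ; order-iff = λ a b → g'-mono a b , g'-reflects a b }

      image-g'? : ∀ u → Dec (GP.Image g' u)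
      image-g'? u = any-DK _ (λ a → g' a Fin.≟ u)

      g'-convex : OP.Convex (GP.Image g')
      g'-convex a b d (α , refl) (δ , refl) ab bd with image-g'? b
      ... | yes p = p
      ... | no np = ⊥-elim (¬¬ι-mono ab λ le1 → ¬¬ι-mono bd λ le2 → ¬¬mem {g' α} {b} (mem-g' α) λ mb →
            np (let (β , gb) = gConv (g α) (ι b , mb) (g δ) (α , refl) (δ , refl)
                                 (subst (_≤X ι b) (ι-g' α) le1) (subst (ι b ≤X_) (ι-g' δ) le2)
                in β , ι-injective (trans (ι-g' β) gb)))

      g'-isoOnto : OP.IsoOnto (DK s e') _≤DK_ (GP.Image g')
      g'-isoOnto = GP.embedding⇒isoOnto (GP.Image g') g' g'-embedding (λ u → (λ x → x) , (λ x → x))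


    module Pushforward {s e'} (h' : DK s e' → Fin n) (hE : GP.IsDKEmbedding h') (hConv : OP.Convex (GP.Image h'))
               (memh : ∀ a → Mem (ι (h' a))) where
      h : DK s e' → C
      h a = ι (h' a) , memh a

      h-mono : ∀ a b → a ≤DK b → ι (h' a) ≤X ι (h' b)
      h-mono a b ab = go (≤DK⇒cover-chain a b ab)
        where
        go : ∀ {a b} → Star (Order._⋖_ _≡_ _≤DK_) a b → ι (h' a) ≤X ι (h' b)
        go ε = Xrefl
        go (cv ◅ r) = Xtrans (ι-⋖ (GP.embedding-preserves-⋖ h' hE hConv _ _ cv)) (go r)

      h-embedding : GC.IsDKEmbedding h
      h-embedding = record { injective = λ a b eq → GP.injective hE a b (ι-injective eq)
                   ; order-iff = λ a b → h-mono a b , λ le → proj₂ (GP.order-iff hE a b) (ι-reflects le) }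

      h'-mono-on-image : ∀ x y → GP.Image h' x → GP.Image h' y → x ⊑ y → ι x ≤X ι y
      h'-mono-on-image x y (a , refl) (b , refl) xy = h-mono a b (proj₂ (GP.order-iff hE a b) xy)

    module CoverAboveTop {s} (g : DK s s → C) (gE : GC.IsDKEmbedding g) (gConv : OC.Convex (GC.Image g))
                    (inP : ∀ a → Σ (Fin n) λ c → proj₁ (g a) ≡ ι c) where
      open Pullback g gE gConv inP

      top-maximal : OP.MaxIn (GP.Image g') (g' dk⁻Top)
      top-maximal = (dk⁻Top , refl) , λ { u (b , refl) le → cong g' (dk⁻Top-maximal b (g'-reflects dk⁻Top b le)) }

      cover : Σ C λ p → (proj₁ (g dk⁻Top) ≤X proj₁ p × ¬ (proj₁ (g dk⁻Top) ≡ proj₁ p)) × Σ (Fin n) λ c → proj₁ p ≡ ι c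
      cover = let (p' , covs , _) = proj₁ (Piece.dc π) s (GP.Image g') (g'-convex , g'-isoOnto) ; cv = covs (g' dk⁻Top) top-maximal in
        (ι p' , memUp cv (mem-g' dk⁻Top)) ,
        (subst (_≤X ι p') (ι-g' dk⁻Top) (ι-⋖ cv) , λ eq → proj₂ (proj₁ cv) (ι-injective (trans (ι-g' dk⁻Top) eq))) ,
        p' , refl

    module Condition₁ {s} (I : C → Set) (g : DK s s → C) (gE : GC.IsDKEmbedding g) (im : ∀ u → I u iff GC.Image g u)
                 (gConv : OC.Convex (GC.Image g)) (inP : ∀ a → Σ (Fin n) λ c → proj₁ (g a) ≡ ι c) where
      open Pullback g gE gConv inP

      open CoverAboveTop g gE gConv inP using (top-maximal)

      module Build (p' : Fin n) (covs : ∀ q → OP.MaxIn (GP.Image g') q → q OP.⋖ p') (w' : Fin n)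
                   (dk' : OP.DkInterval s w' p') (ivl' : ∀ u → OP.Interval w' p' u iff (GP.Image g' u ⊎ u ≡ p')) where
        memp : Mem (ι p')
        memp = memUp (covs (g' dk⁻Top) top-maximal) (mem-g' dk⁻Top)

        p : C
        p = ι p' , memp

        hI = GP.isoOnto⇒embedding (OP.Interval w' p') dk'
        h' = proj₁ hI
        hE = proj₁ (proj₂ hI)
        hIm = proj₂ (proj₂ hI)

        memI : ∀ u → OP.Interval w' p' u → Mem (ι u)
        memI u iv with proj₁ (ivl' u) iv
        ... | inj₁ (a , refl) = mem-g' a
        ... | inj₂ refl = memp

        hConv = GP.image-convex (OP.Interval w' p') h' hIm (interval-convex _≡_ Ptrans w' p')

        memh : ∀ a → Mem (ι (h' a))
        memh a = memI (h' a) (proj₂ (hIm (h' a)) (a , refl))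

        open Pushforward h' hE hConv memh

        imgI : ∀ x → OP.Interval w' p' x → GP.Image h' x
        imgI x iv = proj₁ (hIm x) iv

        w'p' : w' ⊑ p'
        w'p' = let iv = proj₂ (hIm (h' (c fzero))) (c fzero , refl) in Ptrans (proj₁ iv) (proj₂ iv)

        ivw : OP.Interval w' p' w'
        ivw = Prefl , w'p'
        ivp : OP.Interval w' p' p'
        ivp = w'p' , Prefl

        w : C
        w = ι w' , memI w' ivw

        ivlC : ∀ x → OP.Interval w' p' x → ∀ u → proj₁ u ≡ ι x → OC.Interval w p u
        ivlC x iv u eq = subst (ι w' ≤X_) (sym eq) (h'-mono-on-image w' x (imgI w' ivw) (imgI x iv) (proj₁ iv)) ,
                         subst (_≤X ι p') (sym eq) (h'-mono-on-image x p' (imgI x iv) (imgI p' ivp) (proj₂ iv))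

        toP : ∀ u → OC.Interval w p u → Σ (Fin n) λ c → proj₁ u ≡ ι c × OP.Interval w' p' c
        toP u (wu , up) = let (c0 , ueq) = ι-convex wu up in
          c0 , ueq , ι-reflects (subst (ι w' ≤X_) ueq wu) , ι-reflects (subst (_≤X ι p') ueq up)

        covers : ∀ q → OC.MaxIn I q → q OC.⋖ p
        covers q (Iq , mx) with proj₁ (im q) Iq
        ... | (a , gaq) = (qle , qne) , qnb
          where
          ga≡ : ι (g' a) ≡ proj₁ q
          ga≡ = trans (ι-g' a) gaq
          mxP : OP.MaxIn (GP.Image g') (g' a)
          mxP = (a , refl) , λ { u (b , refl) le →
                  ι-injective (trans (ι-g' b) (trans (mx (g b) (proj₂ (im (g b)) (b , refl))
                         (subst (_≤X proj₁ (g b)) gaq (proj₁ (GC.order-iff gE a b) (g'-reflects a b le))))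
                       (sym ga≡))) }
          cv = covs (g' a) mxP
          qle : proj₁ q ≤X ι p'
          qle = subst (_≤X ι p') ga≡ (ι-⋖ cv)
          qne : ¬ (proj₁ q ≡ ι p')
          qne eq = proj₂ (proj₁ cv) (ι-injective (trans ga≡ eq))
          qnb : ∀ d → q OC.<ₒ d → d OC.<ₒ p → ⊥
          qnb d (qd , nqd) (dp , ndp) =
            let (c0 , deq) = ι-convex (subst (_≤X proj₁ d) (sym ga≡) qd) dp in
            proj₂ cv c0 (ι-reflects (subst₂ _≤X_ (sym ga≡) deq qd) ,
                         λ eq → nqd (trans (sym ga≡) (trans (cong ι eq) (sym deq))))
                        (ι-reflects (subst (_≤X ι p') deq dp) , λ eq → ndp (trans deq (cong ι eq)))

        dkC : OC.DkInterval s w p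
        dkC = GC.embedding⇒isoOnto (OC.Interval w p) h h-embedding
                (λ u → (λ iv → let (c0 , ueq , ivp0) = toP u iv ; (a , h'a) = imgI c0 ivp0 in
                                 a , trans (cong ι h'a) (sym ueq)) ,
                       (λ { (a , eq) → ivlC (h' a) (proj₂ (hIm (h' a)) (a , refl)) u (sym eq) }))

        iffW : ∀ u → OC.Interval w p u iff (I u ⊎ u ≈C p)
        iffW u = fwd , bwd
          where
          fwd : OC.Interval w p u → I u ⊎ u ≈C p
          fwd iv with toP u iv
          ... | (c0 , ueq , ivp0) with proj₁ (ivl' c0) ivp0
          ...   | inj₁ (a , ga) = inj₁ (proj₂ (im u) (a , trans (sym (ι-g' a)) (trans (cong ι ga) (sym ueq))))
          ...   | inj₂ cp = inj₂ (trans ueq (cong ι cp))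
          bwd : I u ⊎ u ≈C p → OC.Interval w p u
          bwd (inj₁ Iu) = let (a , gau) = proj₁ (im u) Iu in
            ivlC (g' a) (proj₂ (ivl' (g' a)) (inj₁ (a , refl))) u (trans (sym gau) (sym (ι-g' a)))
          bwd (inj₂ up) = ivlC p' ivp u up

        holds : CoverCompletion I
        holds = p , covers , w , dkC , iffW

      holds : CoverCompletion I
      holds = let (p' , covs , w' , dk' , ivl') = proj₁ (Piece.dc π) s (GP.Image g') (g'-convex , g'-isoOnto) in
              Build.holds p' covs w' dk' ivl'

    module Condition₂ {s} (w z : C) (h : DK s (suc s) → C) (hE : GC.IsDKEmbedding h) (him : ∀ u → OC.Interval w z u iff GC.Image h u)
                 (inP : ∀ a → Σ (Fin n) λ c → proj₁ (h a) ≡ ι c) where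
      hConvC : OC.Convex (GC.Image h)
      hConvC = GC.image-convex (OC.Interval w z) h him (interval-convex _≈C_ Xtrans w z)
      open Pullback h hE hConvC inP

      w'' z'' : Fin n
      w'' = g' (c fzero)
      z'' = g' dkTop

      dk' : OP.DkInterval s w'' z''
      dk' = GP.embedding⇒isoOnto _ g' g'-embedding (λ x → (λ iv → g'-convex _ x _ (c fzero , refl) (dkTop , refl) (proj₁ iv) (proj₂ iv)) ,
                                     λ { (a , refl) → g'-mono _ _ (c0-≤DK a) , g'-mono _ _ (≤DK-dkTop a) })

      topEq : proj₁ (h dkTop) ≡ proj₁ z
      topEq = Xantisym hz zh
        where
        ivh : OC.Interval w z (h dkTop)
        ivh = proj₂ (him (h dkTop)) (dkTop , refl)
        ivc : OC.Interval w z (h (c fzero))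
        ivc = proj₂ (him (h (c fzero))) (c fzero , refl)
        hz : proj₁ (h dkTop) ≤X proj₁ z
        hz = proj₂ ivh
        ivz : OC.Interval w z z
        ivz = Xtrans (proj₁ ivc) (proj₂ ivc) , Xrefl
        zh : proj₁ z ≤X proj₁ (h dkTop)
        zh = let (az , haz) = proj₁ (him z) ivz in subst (_≤X proj₁ (h dkTop)) haz (proj₁ (GC.order-iff hE az dkTop) (≤DK-dkTop az))

      ez : ι z'' ≡ proj₁ z
      ez = trans (ι-g' dkTop) topEq

      holds : ∀ u → u OC.⋖ z → (Σ (Fin n) λ c → proj₁ u ≡ ι c) → OC.Interval w z u
      holds u ((uz , nuz) , nb) (u' , ueq) =
        let iv = proj₁ (proj₂ (Piece.dc π)) s w'' z'' dk' u' ucov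
            (a , ga) = g'-convex w'' u' z'' (c fzero , refl) (dkTop , refl) (proj₁ iv) (proj₂ iv)
        in proj₂ (him u) (a , trans (sym (ι-g' a)) (trans (cong ι ga) (sym ueq)))
        where
        ucov : u' OP.⋖ z''
        ucov = (ι-reflects (subst₂ _≤X_ ueq (sym ez) uz) , λ eq → nuz (trans ueq (trans (cong ι eq) ez))) ,
               λ d (ud , nud) (dz , ndz) → ¬¬ι-mono ud λ le1 → ¬¬ι-mono dz λ le2 → ¬¬mem {g' dkTop} {d} (mem-g' dkTop) λ md →
                 nb (ι d , md) (subst (_≤X ι d) (sym ueq) le1 , λ eq → nud (ι-injective (trans (sym ueq) eq)))
                               (subst (ι d ≤X_) ez le2 , λ eq → ndz (ι-injective (trans eq (sym ez))))

    module NonMinimalTransfer {s} (I J : C → Set) (g k : DK s s → C) (gE : GC.IsDKEmbedding g) (kE : GC.IsDKEmbedding k)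
               (imI : ∀ u → I u iff GC.Image g u) (imJ : ∀ u → J u iff GC.Image k u)
               (gConv : OC.Convex (GC.Image g)) (kConv : OC.Convex (GC.Image k))
               (inPg : ∀ a → Σ (Fin n) λ c → proj₁ (g a) ≡ ι c) (inPk : ∀ a → Σ (Fin n) λ c → proj₁ (k a) ≡ ι c)
               (HIJ : ∀ u → (I u × ¬ OC.MinIn I u) → (J u × ¬ OC.MinIn J u)) where
      module G = Pullback g gE gConv inPg
      module K = Pullback k kE kConv inPk

      dir : ∀ x → (GP.Image G.g' x × ¬ OP.MinIn (GP.Image G.g') x) → (GP.Image K.g' x × ¬ OP.MinIn (GP.Image K.g') x)
      dir x ((a , refl) , nmin) = (b , ι-injective (trans (K.ι-g' b) (trans kbga (sym (G.ι-g' a))))) , λ mJ → nminJ (minC mJ)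
        where
        minP : OC.MinIn I (g a) → OP.MinIn (GP.Image G.g') (G.g' a)
        minP (_ , mn) = (a , refl) , λ { y (b , refl) le →
           ι-injective (trans (G.ι-g' b) (trans (mn (g b) (proj₂ (imI (g b)) (b , refl)) (proj₁ (GC.order-iff gE b a) (G.g'-reflects b a le))) (sym (G.ι-g' a)))) }
        HH = HIJ (g a) (proj₂ (imI (g a)) (a , refl) , λ minC' → nmin (minP minC'))
        Jga = proj₁ HH
        nminJ = proj₂ HH
        b = proj₁ (proj₁ (imJ (g a)) Jga)
        kbga : proj₁ (k b) ≡ proj₁ (g a)
        kbga = proj₂ (proj₁ (imJ (g a)) Jga)
        minC : OP.MinIn (GP.Image K.g') (G.g' a) → OC.MinIn J (g a)
        minC (_ , mn) = Jga , λ v Jv vle →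
          let (b' , kv) = proj₁ (imJ v) Jv
              eq = mn (K.g' b') (b' , refl) (ι-reflects (subst₂ _≤X_ (sym (trans (K.ι-g' b') kv)) (sym (G.ι-g' a)) vle))
          in trans (sym kv) (trans (sym (K.ι-g' b')) (trans (cong ι eq) (G.ι-g' a)))

    module Condition₃ {s} (I J : C → Set) (g k : DK s s → C) (gE : GC.IsDKEmbedding g) (kE : GC.IsDKEmbedding k)
               (imI : ∀ u → I u iff GC.Image g u) (imJ : ∀ u → J u iff GC.Image k u)
               (gConv : OC.Convex (GC.Image g)) (kConv : OC.Convex (GC.Image k))
               (inPg : ∀ a → Σ (Fin n) λ c → proj₁ (g a) ≡ ι c) (inPk : ∀ a → Σ (Fin n) λ c → proj₁ (k a) ≡ ι c)
               (H : ∀ u → (I u × ¬ OC.MinIn I u) iff (J u × ¬ OC.MinIn J u)) where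
      module D1 = NonMinimalTransfer I J g k gE kE imI imJ gConv kConv inPg inPk (λ u → proj₁ (H u))
      module D2 = NonMinimalTransfer J I k g kE gE imJ imI kConv gConv inPk inPg (λ u → proj₂ (H u))
      module G = Pullback g gE gConv inPg
      module K = Pullback k kE kConv inPk

      H' : ∀ x → (GP.Image G.g' x × ¬ OP.MinIn (GP.Image G.g') x) iff (GP.Image K.g' x × ¬ OP.MinIn (GP.Image K.g') x)
      H' x = D1.dir x , D2.dir x

      PI = proj₂ (proj₂ (Piece.dc π)) s (GP.Image G.g') (GP.Image K.g') (G.g'-convex , G.g'-isoOnto) (K.g'-convex , K.g'-isoOnto) H'

      holds : ∀ u → I u iff J u
      holds u = fwd , bwd
        where
        fwd : I u → J u
        fwd Iu = let (a , gau) = proj₁ (imI u) Iu ; (b , kb) = proj₁ (PI (G.g' a)) (a , refl) in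
          proj₂ (imJ u) (b , trans (sym (K.ι-g' b)) (trans (cong ι kb) (trans (G.ι-g' a) gau)))
        bwd : J u → I u
        bwd Ju = let (b , kbu) = proj₁ (imJ u) Ju ; (a , ga) = proj₂ (PI (K.g' b)) (b , refl) in
          proj₂ (imI u) (a , trans (sym (G.ι-g' a)) (trans (cong ι ga) (trans (K.ι-g' b) kbu)))




-- The folded mobile P_F

-- pointsUp M b holds when z_b < z_(b+1) in P_F: F reverses exactly the folded ribbon edges.
pointsUp : (M : Mobile) → Fin (Mobile.L M) → Bool
pointsUp M b = if Mobile.S M b then MobileP.folded M b else not (MobileP.folded M b)

OrientedTowards : (M : Mobile) → Fin (suc (Mobile.L M)) → Set
OrientedTowards M root =
  ∀ b → (T (pointsUp M b) → suc (toℕ b) ≤ toℕ root) × (¬ T (pointsUp M b) → toℕ root ≤ toℕ b)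

T⇒≡true : ∀ {x} → T x → x ≡ true
T⇒≡true {true} _ = refl

T-not⇒≡false : ∀ {x} → T (not x) → x ≡ false
T-not⇒≡false {false} _ = refl

module FoldedMobile (M : Mobile) (root : Fin (suc (Mobile.L M)))
  (Q-isPO : IsPartialOrder _≡_ (MobileP.qLe M))
  (Q-dComplete : Order.DComplete _≡_ (MobileP.qLe M))
  (Q-connected : Order.Connected _≡_ (MobileP.qLe M))
  (anchor-at-root : ∀ {j q} → MobileP.anchorPt M ≡ just (j , q) → j ≡ root)
  (anchor-acyclic : ∀ {j q} → MobileP.anchorPt M ≡ just (j , q) → Order.Acyclic _≡_ (MobileP.qLe M) q)
  (oriented-to-root : OrientedTowards M root)
  where
  open Mobile M
  open MobileP M

  Up : Fin L → Set
  Up b = T (pointsUp M b)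

  ≤Att : (z : Fin (suc L)) (t : Fin (length (attach z))) → Fin (size (attP z t)) → Fin (size (attP z t)) → Set
  ≤Att z t = _≤ₚ_ (attP z t)

  ≤Att-trans : ∀ {z t} {a b d} → ≤Att z t a b → ≤Att z t b d → ≤Att z t a d
  ≤Att-trans {z} {t} = IsPartialOrder.trans (isPO (attP z t))

  ≤Att-refl : ∀ {z t} {a} → ≤Att z t a a
  ≤Att-refl {z} {t} = IsPartialOrder.refl (isPO (attP z t))

  ≤Att-antisym : ∀ {z t} {a b} → ≤Att z t a b → ≤Att z t b a → a ≡ b
  ≤Att-antisym {z} {t} = IsPartialOrder.antisym (isPO (attP z t))

  ≤P-att-inv : ∀ {x z t v} → x ≤P att z t v → Σ (Fin (size (attP z t))) λ u → x ≡ att z t u × ≤Att z t u v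
  ≤P-att-inv ε = _ , refl , ≤Att-refl
  ≤P-att-inv (g ◅ rest) with ≤P-att-inv rest
  ... | u' , refl , le with g
  ...   | inAtt _ _ u'' _ p = u'' , refl , ≤Att-trans p le

  att-≤P-inv : ∀ {z t u y} → att z t u ≤P y →
        (Σ (Fin (size (attP z t))) λ v → y ≡ att z t v × ≤Att z t u v) ⊎ (att z t u ≤P rib z × rib z ≤P y)
  att-≤P-inv ε = inj₁ (_ , refl , ≤Att-refl)
  att-≤P-inv (inAtt _ _ _ v p ◅ rest) with att-≤P-inv rest
  ... | inj₁ (v' , eq , le) = inj₁ (v' , eq , ≤Att-trans p le)
  ... | inj₂ (a , b) = inj₂ (inAtt _ _ _ v p ◅ a , b)
  att-≤P-inv (g@(attTop _ _ _ mx) ◅ rest) = inj₂ (g ◅ ε , rest)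

  anc-≤P-inv : ∀ {u y} → anc u ≤P y → Σ (Fin qsize) λ v → y ≡ anc v × Star qLe u v
  anc-≤P-inv ε = _ , refl , ε
  anc-≤P-inv (inQ _ v p ◅ rest) with anc-≤P-inv rest
  ... | v' , eq , le = v' , eq , p ◅ le

  rib≰P-att : ∀ {a z t v} → rib a ≤P att z t v → ⊥
  rib≰P-att p with ≤P-att-inv p
  ... | _ , () , _

  anc≰P-rib : ∀ {u a} → anc u ≤P rib a → ⊥
  anc≰P-rib p with anc-≤P-inv p
  ... | _ , () , _


  UpRun DownRun Run : Fin (suc L) → Fin (suc L) → Set
  UpRun a cc = toℕ a ≤ toℕ cc × (∀ (b : Fin L) → toℕ a ≤ toℕ b → toℕ b < toℕ cc → S b ≡ false)
  DownRun a cc = toℕ cc ≤ toℕ a × (∀ (b : Fin L) → toℕ cc ≤ toℕ b → toℕ b < toℕ a → S b ≡ true)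
  Run a cc = UpRun a cc ⊎ DownRun a cc

  private
    squeeze : ∀ {x y} → y ≤ x → x < suc y → x ≡ y
    squeeze l1 l2 = ℕ.≤-antisym (ℕ.≤-pred l2) l1

  run-prepend-up : (b : Fin L) → S b ≡ false → ∀ cc → Run (fsuc b) cc → Run (inject₁ b) cc
  run-prepend-up b sb cc (inj₁ (le , f)) = inj₁ (subst (_≤ toℕ cc) (sym (Fin.toℕ-inject₁ b)) (ℕ.≤-trans (ℕ.n≤1+n _) le) , g)
    where
    g : ∀ (b' : Fin L) → toℕ (inject₁ b) ≤ toℕ b' → toℕ b' < toℕ cc → S b' ≡ false
    g b' l1 l2 with toℕ b' ℕ.≟ toℕ b
    ... | yes eq = subst (λ x → S x ≡ false) (sym (Fin.toℕ-injective eq)) sb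
    ... | no ne = f b' (ℕ.≤∧≢⇒< (subst (_≤ toℕ b') (Fin.toℕ-inject₁ b) l1) (λ e → ne (sym e))) l2
  run-prepend-up b sb cc (inj₂ (le , f)) with toℕ cc ℕ.≟ suc (toℕ b)
  ... | yes ceq = inj₁ (subst (_≤ toℕ cc) (sym (Fin.toℕ-inject₁ b)) (subst (toℕ b ≤_) (sym ceq) (ℕ.n≤1+n _)) , g)
    where
    g : ∀ (b' : Fin L) → toℕ (inject₁ b) ≤ toℕ b' → toℕ b' < toℕ cc → S b' ≡ false
    g b' l1 l2 = subst (λ x → S x ≡ false) (sym (Fin.toℕ-injective
                   (squeeze (subst (_≤ toℕ b') (Fin.toℕ-inject₁ b) l1) (subst (toℕ b' <_) ceq l2)))) sb
  ... | no cne = ⊥-elim (true≢false (trans (sym (f b (ℕ.≤-pred (ℕ.≤∧≢⇒< le cne)) (ℕ.n<1+n _))) sb))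
    where
    true≢false : true ≡ false → ⊥
    true≢false ()

  run-prepend-down : (b : Fin L) → S b ≡ true → ∀ cc → Run (inject₁ b) cc → Run (fsuc b) cc
  run-prepend-down b sb cc (inj₂ (le , f)) = inj₂ (ℕ.≤-trans (subst (toℕ cc ≤_) (Fin.toℕ-inject₁ b) le) (ℕ.n≤1+n _) , g)
    where
    g : ∀ (b' : Fin L) → toℕ cc ≤ toℕ b' → toℕ b' < suc (toℕ b) → S b' ≡ true
    g b' l1 l2 with toℕ b' ℕ.≟ toℕ b
    ... | yes eq = subst (λ x → S x ≡ true) (sym (Fin.toℕ-injective eq)) sb
    ... | no ne = f b' l1 (subst (toℕ b' <_) (sym (Fin.toℕ-inject₁ b)) (ℕ.≤∧≢⇒< (ℕ.≤-pred l2) ne))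
  run-prepend-down b sb cc (inj₁ (le , f)) with toℕ cc ℕ.≟ toℕ b
  ... | yes ceq = inj₂ (subst (_≤ suc (toℕ b)) (sym ceq) (ℕ.n≤1+n _) , g)
    where
    g : ∀ (b' : Fin L) → toℕ cc ≤ toℕ b' → toℕ b' < suc (toℕ b) → S b' ≡ true
    g b' l1 l2 = subst (λ x → S x ≡ true) (sym (Fin.toℕ-injective (squeeze (subst (_≤ toℕ b') ceq l1) l2))) sb
  ... | no cne = ⊥-elim (false≢true (trans (sym (f b (ℕ.≤-reflexive (Fin.toℕ-inject₁ b))
                   (ℕ.≤∧≢⇒< (subst (_≤ toℕ cc) (Fin.toℕ-inject₁ b) le) (λ e → cne (sym e))))) sb))
    where
    false≢true : false ≡ true → ⊥
    false≢true ()

  rib-≤P-inv : ∀ {a y} → rib a ≤P y → (Σ (Fin (suc L)) λ cc → y ≡ rib cc × Run a cc) ⊎ (Σ (Fin qsize) λ v → y ≡ anc v)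
  rib-≤P-inv {a} ε = inj₁ (a , refl , inj₁ (ℕ.≤-refl , λ b l1 l2 → ⊥-elim (ℕ.<-irrefl refl (ℕ.≤-<-trans l1 l2))))
  rib-≤P-inv (ribUp b ns ◅ rest) with rib-≤P-inv rest
  ... | inj₁ (c' , eq , pr) = inj₁ (c' , eq , run-prepend-up b (T-not⇒≡false ns) c' pr)
  ... | inj₂ x = inj₂ x
  rib-≤P-inv (ribDown b sb ◅ rest) with rib-≤P-inv rest
  ... | inj₁ (c' , eq , pr) = inj₁ (c' , eq , run-prepend-down b (T⇒≡true sb) c' pr)
  ... | inj₂ x = inj₂ x
  rib-≤P-inv (ancEdge j q eq ◅ rest) with anc-≤P-inv rest
  ... | v , e , _ = inj₂ (v , e)

  rib-≤P-antisym : ∀ {a cc} → rib a ≤P rib cc → rib cc ≤P rib a → a ≡ cc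
  rib-≤P-antisym {a} {cc} p q with rib-≤P-inv p | rib-≤P-inv q
  ... | inj₂ (_ , ()) | _
  ... | inj₁ _ | inj₂ (_ , ())
  ... | inj₁ (c1 , refl , pr1) | inj₁ (a1 , refl , pr2) = Fin.toℕ-injective (go pr1 pr2)
    where
    mkb : ∀ {x y : Fin (suc L)} → toℕ x < toℕ y → Fin L
    mkb {x} {y} lt = fromℕ< (ℕ.<-≤-trans lt (Fin.toℕ≤pred[n] y))
    tb : ∀ {x y : Fin (suc L)} (lt : toℕ x < toℕ y) → toℕ (mkb lt) ≡ toℕ x
    tb {x} {y} lt = Fin.toℕ-fromℕ< (ℕ.<-≤-trans lt (Fin.toℕ≤pred[n] y))
    ft : false ≡ true → ⊥
    ft ()
    go : Run _ _ → Run _ _ → toℕ a ≡ toℕ c1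
    go (inj₁ (l1 , _)) (inj₁ (l2 , _)) = ℕ.≤-antisym l1 l2
    go (inj₂ (l1 , _)) (inj₂ (l2 , _)) = ℕ.≤-antisym l2 l1
    go (inj₁ (l1 , f1)) (inj₂ (l2 , f2)) with toℕ a ℕ.≟ toℕ c1
    ... | yes e = e
    ... | no ne = let lt = ℕ.≤∧≢⇒< l1 ne in
          ⊥-elim (ft (trans (sym (f1 (mkb lt) (ℕ.≤-reflexive (sym (tb lt))) (subst (_< _) (sym (tb lt)) lt)))
                            (f2 (mkb lt) (ℕ.≤-reflexive (sym (tb lt))) (subst (_< _) (sym (tb lt)) lt))))
    go (inj₂ (l1 , f1)) (inj₁ (l2 , f2)) with toℕ c1 ℕ.≟ toℕ a
    ... | yes e = sym e
    ... | no ne = let lt = ℕ.≤∧≢⇒< l1 ne in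
          ⊥-elim (ft (trans (sym (f2 (mkb lt) (ℕ.≤-reflexive (sym (tb lt))) (subst (_< _) (sym (tb lt)) lt)))
                            (f1 (mkb lt) (ℕ.≤-reflexive (sym (tb lt))) (subst (_< _) (sym (tb lt)) lt))))

  Star⇒≤Q : ∀ {u v} → Star qLe u v → qLe u v
  Star⇒≤Q ε = IsPartialOrder.refl Q-isPO
  Star⇒≤Q (p ◅ ps) = IsPartialOrder.trans Q-isPO p (Star⇒≤Q ps)

  _≟Elem_ : (x y : Elem) → Dec (x ≡ y)
  _≟Elem_ (rib a) (rib b) with a Fin.≟ b
  ... | yes refl = yes refl
  ... | no ne = no λ { refl → ne refl }
  _≟Elem_ (rib a) (att _ _ _) = no λ ()
  _≟Elem_ (rib a) (anc _) = no λ ()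
  _≟Elem_ (att _ _ _) (rib _) = no λ ()
  _≟Elem_ (att z t u) (att z' t' u') with z Fin.≟ z'
  ... | no ne = no λ { refl → ne refl }
  ... | yes refl with t Fin.≟ t'
  ...   | no ne = no λ { refl → ne refl }
  ...   | yes refl with u Fin.≟ u'
  ...     | no ne = no λ { refl → ne refl }
  ...     | yes refl = yes refl
  _≟Elem_ (att _ _ _) (anc _) = no λ ()
  _≟Elem_ (anc _) (rib _) = no λ ()
  _≟Elem_ (anc _) (att _ _ _) = no λ ()
  _≟Elem_ (anc u) (anc v) with u Fin.≟ v
  ... | yes refl = yes refl
  ... | no ne = no λ { refl → ne refl }

  inject₁≢fsuc : ∀ (b : Fin L) → ¬ (inject₁ b ≡ fsuc b)
  inject₁≢fsuc b eq = ℕ.1+n≢n (sym (trans (sym (Fin.toℕ-inject₁ b)) (cong toℕ eq)))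

  Gen-rib-irrefl : ∀ {a d} → Gen (rib a) d → ¬ (rib a ≡ d)
  Gen-rib-irrefl (ribDown b _) eq = inject₁≢fsuc b (sym (cong (λ { (rib x) → x ; _ → fzero }) eq))
  Gen-rib-irrefl (ribUp b _) eq = inject₁≢fsuc b (cong (λ { (rib x) → x ; _ → fzero }) eq)
  Gen-rib-irrefl (ancEdge _ _ _) ()

  att-injective : ∀ {z t a b} → att z t a ≡ att z t b → a ≡ b
  att-injective refl = refl

  anc-injective : ∀ {a b} → anc a ≡ anc b → a ≡ b
  anc-injective refl = refl

  att-⋖P : ∀ {z t a b} → Order._⋖_ _≡_ (≤Att z t) a b → att z t a ⋖P att z t b
  att-⋖P {z} {t} {a} {b} ((ab , nab) , nb) = (inAtt z t a b ab ◅ ε , λ eq → nab (att-injective eq)) , between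
    where
    between : ∀ d → Order._<ₒ_ _≡_ _≤P_ (att z t a) d → Order._<ₒ_ _≡_ _≤P_ d (att z t b) → ⊥
    between d (ad , nad) (db , ndb) with ≤P-att-inv db
    ... | u , refl , ub with att-≤P-inv ad
    ...   | inj₂ (_ , q) = rib≰P-att q
    ...   | inj₁ (u' , eq , au) with att-injective eq
    ...     | refl = nb u (au , λ e → nad (cong (att z t) e)) (ub , λ e → ndb (cong (att z t) e))

  anc-⋖P : ∀ {a b} → Order._⋖_ _≡_ qLe a b → anc a ⋖P anc b
  anc-⋖P {a} {b} ((ab , nab) , nb) = (inQ a b ab ◅ ε , λ eq → nab (anc-injective eq)) , between
    where
    between : ∀ d → Order._<ₒ_ _≡_ _≤P_ (anc a) d → Order._<ₒ_ _≡_ _≤P_ d (anc b) → ⊥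
    between d (ad , nad) (db , ndb) with anc-≤P-inv ad
    ... | u , refl , au with anc-≤P-inv db
    ...   | u' , eq , ub with anc-injective eq
    ...     | refl = nb u (Star⇒≤Q au , λ e → nad (cong anc e)) (Star⇒≤Q ub , λ e → ndb (cong anc e))

  attTop-⋖P : ∀ {z t m} → (∀ v → ≤Att z t m v → v ≡ m) → att z t m ⋖P rib z
  attTop-⋖P {z} {t} {m} mx = (attTop z t m mx ◅ ε , λ ()) , between
    where
    between : ∀ d → Order._<ₒ_ _≡_ _≤P_ (att z t m) d → Order._<ₒ_ _≡_ _≤P_ d (rib z) → ⊥
    between d (ad , nad) (db , ndb) with att-≤P-inv ad
    ... | inj₁ (v , refl , mv) = nad (cong (att z t) (sym (mx v mv)))
    ... | inj₂ (_ , zd) with rib-≤P-inv zd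
    ...   | inj₂ (v , refl) = anc≰P-rib db
    ...   | inj₁ (cc , refl , _) = ndb (cong rib (sym (rib-≤P-antisym zd db)))

  att-⋖P-inv : ∀ {z t u y} → att z t u ⋖P y → (Σ (Fin (size (attP z t))) λ v → y ≡ att z t v) ⊎ y ≡ rib z
  att-⋖P-inv {z} {t} {u} {y} ((p , ne) , nb) with att-≤P-inv p
  ... | inj₁ (v , eq , _) = inj₁ (v , eq)
  ... | inj₂ (p1 , p2) with _≟Elem_ (rib z) y
  ...   | yes eq = inj₂ (sym eq)
  ...   | no neq = ⊥-elim (nb (rib z) (p1 , λ ()) (p2 , neq))

  anc-⋖P-inv : ∀ {u y} → anc u ⋖P y → Σ (Fin qsize) λ v → y ≡ anc v
  anc-⋖P-inv ((p , _) , _) with anc-≤P-inv p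
  ... | v , eq , _ = v , eq

  rib-⋖P⇒Gen : ∀ {a y} → rib a ⋖P y → Gen (rib a) y
  rib-⋖P⇒Gen ((ε , ne) , nb) = ⊥-elim (ne refl)
  rib-⋖P⇒Gen {a} {y} ((_◅_ {j = d} g rest , ne) , nb) with _≟Elem_ d y
  ... | yes refl = g
  ... | no neq = ⊥-elim (nb d (g ◅ ε , Gen-rib-irrefl g) (rest , neq))

  FStep : Elem → Elem → Set
  FStep a b = ((a ⋖P b) × ¬ F a b) ⊎ F b a

  data RibStep : Fin (suc L) → Fin (suc L) → Set where
    stepUp : (b : Fin L) → Up b → RibStep (inject₁ b) (fsuc b)
    stepDown : (b : Fin L) → ¬ Up b → RibStep (fsuc b) (inject₁ b)

  private
    ¬T⇒≡false : ∀ {x} → ¬ T x → x ≡ false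
    ¬T⇒≡false {false} _ = refl
    ¬T⇒≡false {true} h = ⊥-elim (h tt)

  up-if-rising-unfolded : ∀ b → S b ≡ false → folded b ≡ false → Up b
  up-if-rising-unfolded b s f rewrite s | f = tt
  up-if-falling-folded : ∀ b → S b ≡ true → folded b ≡ true → Up b
  up-if-falling-folded b s f rewrite s | f = tt
  down-if-falling-unfolded : ∀ b → S b ≡ true → folded b ≡ false → ¬ Up b
  down-if-falling-unfolded b s f rewrite s | f = λ ()
  down-if-rising-folded : ∀ b → S b ≡ false → folded b ≡ true → ¬ Up b
  down-if-rising-folded b s f rewrite s | f = λ ()

  FStep-rib-inv : ∀ {a y} → FStep (rib a) y →
          (Σ (Fin (suc L)) λ cc → y ≡ rib cc × RibStep a cc) ⊎
          (Σ (Fin qsize) λ q → y ≡ anc q × anchorPt ≡ just (a , q) × (rib a ⋖P anc q × ¬ F (rib a) (anc q)))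
  FStep-rib-inv (inj₁ (cv , nf)) with rib-⋖P⇒Gen cv
  ... | ribUp b ns = inj₁ (_ , refl , stepUp b (up-if-rising-unfolded b (T-not⇒≡false ns)
                        (¬T⇒≡false λ fo → nf (b , fo , inj₂ (ns , refl , refl)))))
  ... | ribDown b s = inj₁ (_ , refl , stepDown b (down-if-falling-unfolded b (T⇒≡true s)
                          (¬T⇒≡false λ fo → nf (b , fo , inj₁ (s , refl , refl)))))
  ... | ancEdge j q eq = inj₂ (q , refl , eq , cv , nf)
  FStep-rib-inv (inj₂ (b , fo , inj₁ (s , refl , refl))) = inj₁ (_ , refl , stepUp b (up-if-falling-folded b (T⇒≡true s) (T⇒≡true fo)))
  FStep-rib-inv (inj₂ (b , fo , inj₂ (ns , refl , refl))) =
    inj₁ (_ , refl , stepDown b (down-if-rising-folded b (T-not⇒≡false ns) (T⇒≡true fo)))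


  F-source-rib : ∀ {x y} → F x y → Σ (Fin (suc L)) λ a → x ≡ rib a
  F-source-rib (b , _ , inj₁ (_ , refl , _)) = _ , refl
  F-source-rib (b , _ , inj₂ (_ , refl , _)) = _ , refl

  F-target-rib : ∀ {x y} → F x y → Σ (Fin (suc L)) λ a → y ≡ rib a
  F-target-rib (b , _ , inj₁ (_ , _ , refl)) = _ , refl
  F-target-rib (b , _ , inj₂ (_ , _ , refl)) = _ , refl

  ¬F-from-att : ∀ {x z t u} → F (att z t u) x → ⊥
  ¬F-from-att f with F-source-rib f
  ... | _ , ()

  ¬F-to-att : ∀ {x z t u} → F x (att z t u) → ⊥
  ¬F-to-att f with F-target-rib f
  ... | _ , ()

  ¬F-from-anc : ∀ {x u} → F (anc u) x → ⊥
  ¬F-from-anc f with F-source-rib f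
  ... | _ , ()

  ¬F-to-anc : ∀ {x u} → F x (anc u) → ⊥
  ¬F-to-anc f with F-target-rib f
  ... | _ , ()

  ≤F-att-inv : ∀ {x z t v} → x ≤F att z t v → Σ (Fin (size (attP z t))) λ u → x ≡ att z t u × ≤Att z t u v
  ≤F-att-inv ε = _ , refl , ≤Att-refl
  ≤F-att-inv (st ◅ rest) with ≤F-att-inv rest
  ... | u' , refl , le with st
  ...   | inj₂ f = ⊥-elim (¬F-from-att f)
  ...   | inj₁ (cv , _) with ≤P-att-inv (proj₁ (proj₁ cv))
  ...     | u'' , refl , le' = u'' , refl , ≤Att-trans le' le

  att-≤F-inv : ∀ {z t u y} → att z t u ≤F y → (Σ (Fin (size (attP z t))) λ v → y ≡ att z t v) ⊎ (att z t u ≤F rib z × rib z ≤F y)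
  att-≤F-inv ε = inj₁ (_ , refl)
  att-≤F-inv (inj₂ f ◅ rest) = ⊥-elim (¬F-to-att f)
  att-≤F-inv (st@(inj₁ (cv , _)) ◅ rest) with att-⋖P-inv cv
  ... | inj₂ refl = inj₂ (st ◅ ε , rest)
  ... | inj₁ (v , refl) with att-≤F-inv rest
  ...   | inj₁ x = inj₁ x
  ...   | inj₂ (p1 , p2) = inj₂ (st ◅ p1 , p2)

  anc-≤F-inv : ∀ {u y} → anc u ≤F y → Σ (Fin qsize) λ v → y ≡ anc v × qLe u v
  anc-≤F-inv ε = _ , refl , IsPartialOrder.refl Q-isPO
  anc-≤F-inv (inj₂ f ◅ rest) = ⊥-elim (¬F-to-anc f)
  anc-≤F-inv (inj₁ (cv , _) ◅ rest) with anc-⋖P-inv cv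
  ... | v , refl with anc-≤F-inv rest
  ...   | v' , eq , le with anc-≤P-inv (proj₁ (proj₁ cv))
  ...     | _ , refl , le0 = v' , eq , IsPartialOrder.trans Q-isPO (Star⇒≤Q le0) le

  FStep-anc-inv : ∀ {x u} → FStep x (anc u) →
     (Σ (Fin qsize) λ w → x ≡ anc w × qLe w u) ⊎
     (Σ (Fin (suc L)) λ a → x ≡ rib a × ((rib a ⋖P anc u) × ¬ F (rib a) (anc u)) × anchorPt ≡ just (a , u))
  FStep-anc-inv (inj₂ f) = ⊥-elim (¬F-from-anc f)
  FStep-anc-inv {rib a} (inj₁ (cv , nf)) with rib-⋖P⇒Gen cv
  ... | ancEdge _ _ eq = inj₂ (a , refl , (cv , nf) , eq)
  FStep-anc-inv {att z t w} (inj₁ (cv , nf)) with att-⋖P-inv cv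
  ... | inj₁ (_ , ())
  ... | inj₂ ()
  FStep-anc-inv {anc w} (inj₁ (cv , nf)) with anc-≤P-inv (proj₁ (proj₁ cv))
  ... | _ , refl , le = inj₁ (w , refl , Star⇒≤Q le)

  ≤F-anc-inv : ∀ {x v} → x ≤F anc v →
     (Σ (Fin qsize) λ u → x ≡ anc u × qLe u v) ⊎
     (Σ (Fin (suc L)) λ j → Σ (Fin qsize) λ q → (x ≤F rib j) × ((rib j ⋖P anc q) × ¬ F (rib j) (anc q)) ×
        anchorPt ≡ just (j , q) × qLe q v)
  ≤F-anc-inv ε = inj₁ (_ , refl , IsPartialOrder.refl Q-isPO)
  ≤F-anc-inv (st ◅ rest) with ≤F-anc-inv rest
  ... | inj₂ (j , q , p , cv , eq , le) = inj₂ (j , q , st ◅ p , cv , eq , le)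
  ... | inj₁ (u' , refl , le) with FStep-anc-inv st
  ...   | inj₁ (w , refl , le') = inj₁ (w , refl , IsPartialOrder.trans Q-isPO le' le)
  ...   | inj₂ (a , refl , cv , eq) = inj₂ (a , u' , ε , cv , eq , le)

  Between : Fin (suc L) → Fin (suc L) → Set
  Between a cc = (toℕ a ≤ toℕ cc × toℕ cc ≤ toℕ root) ⊎ (toℕ root ≤ toℕ cc × toℕ cc ≤ toℕ a)

  RibStep-towards-root : ∀ {a a'} → RibStep a a' →
                         (toℕ a < toℕ a' × toℕ a' ≤ toℕ root) ⊎ (toℕ root ≤ toℕ a' × toℕ a' < toℕ a)
  RibStep-towards-root (stepUp b u) = inj₁ (subst (_< suc (toℕ b)) (sym (Fin.toℕ-inject₁ b)) (ℕ.n<1+n _) , proj₁ (oriented-to-root b) u)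
  RibStep-towards-root (stepDown b nu) = inj₂ (subst (toℕ root ≤_) (sym (Fin.toℕ-inject₁ b)) (proj₂ (oriented-to-root b) nu) ,
                            subst (_< suc (toℕ b)) (sym (Fin.toℕ-inject₁ b)) (ℕ.n<1+n _))

  between-step : ∀ {a a' cc} → RibStep a a' → Between a' cc → Between a cc
  between-step rs bt with RibStep-towards-root rs | bt
  ... | inj₁ (l1 , l2) | inj₁ (m1 , m2) = inj₁ (ℕ.≤-trans (ℕ.<⇒≤ l1) m1 , m2)
  ... | inj₁ (l1 , l2) | inj₂ (m1 , m2) = inj₁ (ℕ.≤-trans (ℕ.<⇒≤ l1) (ℕ.≤-trans l2 m1) , ℕ.≤-trans m2 l2)
  ... | inj₂ (l1 , l2) | inj₁ (m1 , m2) = inj₂ (ℕ.≤-trans l1 m1 , ℕ.≤-trans m2 (ℕ.≤-trans l1 (ℕ.<⇒≤ l2)))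
  ... | inj₂ (l1 , l2) | inj₂ (m1 , m2) = inj₂ (m1 , ℕ.≤-trans m2 (ℕ.<⇒≤ l2))

  rib-≤F-inv : ∀ {a y} → rib a ≤F y → (Σ (Fin (suc L)) λ cc → y ≡ rib cc × Between a cc) ⊎ (Σ (Fin qsize) λ v → y ≡ anc v)
  rib-≤F-inv {a} ε with ℕ.≤-total (toℕ a) (toℕ root)
  ... | inj₁ le = inj₁ (a , refl , inj₁ (ℕ.≤-refl , le))
  ... | inj₂ le = inj₁ (a , refl , inj₂ (le , ℕ.≤-refl))
  rib-≤F-inv (st ◅ rest) with FStep-rib-inv st
  ... | inj₂ (q , refl , _) with anc-≤F-inv rest
  ...   | v , eq , _ = inj₂ (v , eq)
  rib-≤F-inv (st ◅ rest) | inj₁ (a' , refl , rs) with rib-≤F-inv rest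
  ...   | inj₂ x = inj₂ x
  ...   | inj₁ (cc , eq , bt) = inj₁ (cc , eq , between-step rs bt)

  between-antisym : ∀ {a cc} → Between a cc → Between cc a → toℕ a ≡ toℕ cc
  between-antisym (inj₁ (l1 , l2)) (inj₁ (m1 , m2)) = ℕ.≤-antisym l1 m1
  between-antisym (inj₁ (l1 , l2)) (inj₂ (m1 , m2)) = ℕ.≤-antisym l1 (ℕ.≤-trans l2 m1)
  between-antisym (inj₂ (l1 , l2)) (inj₁ (m1 , m2)) = ℕ.≤-antisym (ℕ.≤-trans m2 l1) l2
  between-antisym (inj₂ (l1 , l2)) (inj₂ (m1 , m2)) = ℕ.≤-antisym m2 l2

  ≤F-antisym : ∀ {x y} → x ≤F y → y ≤F x → x ≡ y
  ≤F-antisym {att z t u} p q with att-≤F-inv p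
  ... | inj₂ (_ , zy) with ≤F-att-inv (zy ◅◅ q)
  ...   | _ , () , _
  ≤F-antisym {att z t u} p q | inj₁ (v , refl) with ≤F-att-inv p | ≤F-att-inv q
  ... | _ , refl , uv | _ , refl , vu = cong (att z t) (≤Att-antisym uv vu)
  ≤F-antisym {anc u} p q with anc-≤F-inv p
  ... | v , refl , uv with anc-≤F-inv q
  ...   | _ , refl , vu = cong anc (IsPartialOrder.antisym Q-isPO uv vu)
  ≤F-antisym {rib a} p q with rib-≤F-inv p
  ... | inj₂ (v , refl) with anc-≤F-inv q
  ...   | _ , () , _
  ≤F-antisym {rib a} p q | inj₁ (cc , refl , b1) with rib-≤F-inv q
  ... | inj₂ (_ , ())
  ... | inj₁ (_ , refl , b2) = cong rib (Fin.toℕ-injective (between-antisym b1 b2))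

  ≤F-isPartialOrder : IsPartialOrder _≡_ _≤F_
  ≤F-isPartialOrder = record
    { isPreorder = record
      { isEquivalence = isEquivalence
      ; reflexive = λ { refl → ε }
      ; trans = _◅◅_ }
    ; antisym = ≤F-antisym }


  blk-suc : ∀ b → blk (fsuc b) ≡ blk (inject₁ b) + oneIf (folded b)
  blk-suc b = trans (countT-below-suc folded b)
    (cong (_+ oneIf (folded b)) (cong (λ n → countT (λ x → folded x ∧ (toℕ x <ᵇ n))) (sym (Fin.toℕ-inject₁ b))))

  blk-suc-unfolded : ∀ b → folded b ≡ false → blk (fsuc b) ≡ blk (inject₁ b)
  blk-suc-unfolded b f = trans (blk-suc b) (trans (cong (λ x → blk (inject₁ b) + oneIf x) f) (ℕ.+-identityʳ _))

  blk-mono : ∀ {a a'} → toℕ a ≤ toℕ a' → blk a ≤ blk a'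
  blk-mono {a} {a'} le = countT-mono _ _ h
    where
    h : ∀ x → T (folded x ∧ (toℕ x <ᵇ toℕ a)) → T (folded x ∧ (toℕ x <ᵇ toℕ a'))
    h x p with folded x
    ... | true = ℕ.<⇒<ᵇ (ℕ.<-≤-trans (ℕ.<ᵇ⇒< (toℕ x) (toℕ a) p) le)
    ... | false = p

  blockOf : Elem → ℕ
  blockOf (rib a) = blk a
  blockOf (att z t u) = blk z
  blockOf (anc u) = blk root

  unfolded-if-¬F : ∀ {b x y} → ¬ F x y → RibCov b x y → folded b ≡ false
  unfolded-if-¬F {b} nf rc with folded b in eq
  ... | false = refl
  ... | true = ⊥-elim (nf (b , subst T (sym eq) tt , rc))

  blockOf-⋖ : ∀ {x y} → (x ⋖P y) × ¬ F x y → blockOf x ≡ blockOf y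
  blockOf-⋖ {att z t u} (cv , nf) with att-⋖P-inv cv
  ... | inj₁ (v , refl) = refl
  ... | inj₂ refl = refl
  blockOf-⋖ {anc u} (cv , nf) with anc-⋖P-inv cv
  ... | v , refl = refl
  blockOf-⋖ {rib a} (cv , nf) with rib-⋖P⇒Gen cv
  ... | ribUp b ns = sym (blk-suc-unfolded b (unfolded-if-¬F nf (inj₂ (ns , refl , refl))))
  ... | ribDown b s = blk-suc-unfolded b (unfolded-if-¬F nf (inj₁ (s , refl , refl)))
  ... | ancEdge j q eq = cong blk (anchor-at-root eq)

  blockOf-≤⊖ : ∀ {x y} → x ≤⊖ y → blockOf x ≡ blockOf y
  blockOf-≤⊖ ε = refl
  blockOf-≤⊖ (st ◅ rest) = trans (blockOf-⋖ st) (blockOf-≤⊖ rest)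

  blockOf-SameComp : ∀ {x y} → SameComp x y → blockOf x ≡ blockOf y
  blockOf-SameComp ε = refl
  blockOf-SameComp (inj₁ p ◅ rest) = trans (blockOf-≤⊖ p) (blockOf-SameComp rest)
  blockOf-SameComp (inj₂ p ◅ rest) = trans (sym (blockOf-≤⊖ p)) (blockOf-SameComp rest)

  -- The window P_{lo,hi}

  module Pij (lo hi : ℕ) where
    Mem : Elem → Set
    Mem = InBlocks lo hi

    mem⇒blockOf-bounds : ∀ {x} → Mem x → lo ≤ blockOf x × blockOf x ≤ hi
    mem⇒blockOf-bounds (a , l , h , sc) = subst (lo ≤_) (sym (blockOf-SameComp sc)) l , subst (_≤ hi) (sym (blockOf-SameComp sc)) h

    blk-bounds⇒mem-rib : ∀ {a} → lo ≤ blk a → blk a ≤ hi → Mem (rib a)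
    blk-bounds⇒mem-rib l h = _ , l , h , ε

    mem-up : ∀ {x y} → (x ⋖P y) × ¬ F x y → Mem x → Mem y
    mem-up st (a , l , h , sc) = a , l , h , (inj₂ (st ◅ ε) ◅ sc)

    mem-down : ∀ {x y} → (x ⋖P y) × ¬ F x y → Mem y → Mem x
    mem-down st (a , l , h , sc) = a , l , h , (inj₁ (st ◅ ε) ◅ sc)

    open Induced Elem _≤F_ ≤F-isPartialOrder Mem public

    attachedPiece : (z : Fin (suc L)) (t : Fin (length (attach z))) → Piece
    attachedPiece z t = record
      { n = size (attP z t)
      ; _⊑_ = ≤Att z t
      ; po = isPO (attP z t)
      ; dc = dcomp (attP z t)
      ; pconn = conn (attP z t)
      ; ι = att z t
      ; ι-injective = att-injective
      ; ι-reflects = λ {a} {b} le → let (u , eq , ub) = ≤F-att-inv le in subst (λ w → ≤Att z t w b) (sym (att-injective eq)) ub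
      ; ι-⋖ = λ cv → inj₁ (att-⋖P cv , ¬F-from-att) ◅ ε
      ; ι-convex = λ _ xb → let (u , eq , _) = ≤F-att-inv xb in u , eq
      ; memUp = λ cv m → mem-up (att-⋖P cv , ¬F-from-att) m
      ; memDown = λ cv m → mem-down (att-⋖P cv , ¬F-from-att) m
      }

    anchoredPiece : Piece
    anchoredPiece = record
      { n = qsize
      ; _⊑_ = qLe
      ; po = Q-isPO
      ; dc = Q-dComplete
      ; pconn = Q-connected
      ; ι = anc
      ; ι-injective = anc-injective
      ; ι-reflects = λ {a} {b} le → let (v , eq , av) = anc-≤F-inv le in subst (qLe a) (sym (anc-injective eq)) av
      ; ι-⋖ = λ cv → inj₁ (anc-⋖P cv , ¬F-from-anc) ◅ ε
      ; ι-convex = λ ax _ → let (v , eq , _) = anc-≤F-inv ax in v , eq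
      ; memUp = λ cv m → mem-up (anc-⋖P cv , ¬F-from-anc) m
      ; memDown = λ cv m → mem-down (anc-⋖P cv , ¬F-from-anc) m
      }

    ¬¬att≤F-rib : ∀ {z t} v → ¬ ¬ (att z t v ≤F rib z)
    ¬¬att≤F-rib {z} {t} v = ¬¬-map below-rib (¬¬-decidable (≤Att z t))
      where
      below-rib : Decidable (≤Att z t) → att z t v ≤F rib z
      below-rib dec =
        let (m , vm , mx) = FinitePoset.maximal-above (isPO (attP z t)) dec v in
        Transfer.ι-chain (attachedPiece z t) (FinitePoset.cover-chain (isPO (attP z t)) dec vm) ◅◅ (inj₁ (attTop-⋖P mx , ¬F-from-att) ◅ ε)

    RibStep-shape : ∀ {a a'} → RibStep a a' →
                    (toℕ a' ≡ suc (toℕ a) × toℕ a < toℕ root) ⊎ (suc (toℕ a') ≡ toℕ a × toℕ root < toℕ a)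
    RibStep-shape (stepUp b u) =
      inj₁ (cong suc (sym (Fin.toℕ-inject₁ b)) , subst (_< toℕ root) (sym (Fin.toℕ-inject₁ b)) (proj₁ (oriented-to-root b) u))
    RibStep-shape (stepDown b nu) = inj₂ (cong suc (Fin.toℕ-inject₁ b) , s≤s (proj₂ (oriented-to-root b) nu))

    RibStep-irreflexive : ∀ {a a'} → RibStep a a' → ¬ (rib a ≡ rib a')
    RibStep-irreflexive rs refl with RibStep-shape rs
    ... | inj₁ (e1 , _) = ℕ.1+n≢n (sym e1)
    ... | inj₂ (e1 , _) = ℕ.1+n≢n e1

    FStep-rib-unique : ∀ {a y1 y2} → FStep (rib a) y1 → FStep (rib a) y2 → y1 ≡ y2
    FStep-rib-unique s1 s2 with FStep-rib-inv s1 | FStep-rib-inv s2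
    ... | inj₁ (a1 , refl , rs1) | inj₁ (a2 , refl , rs2) with RibStep-shape rs1 | RibStep-shape rs2
    ...   | inj₁ (e1 , _) | inj₁ (e2 , _) = cong rib (Fin.toℕ-injective (trans e1 (sym e2)))
    ...   | inj₂ (e1 , _) | inj₂ (e2 , _) = cong rib (Fin.toℕ-injective (ℕ.suc-injective (trans e1 (sym e2))))
    ...   | inj₁ (_ , l1) | inj₂ (_ , l2) = ⊥-elim (ℕ.<-asym l1 l2)
    ...   | inj₂ (_ , l1) | inj₁ (_ , l2) = ⊥-elim (ℕ.<-asym l1 l2)
    FStep-rib-unique s1 s2 | inj₁ (a1 , refl , rs1) | inj₂ (q , refl , eq , _) with RibStep-shape rs1 | anchor-at-root eq
    ... | inj₁ (_ , l) | refl = ⊥-elim (ℕ.<-irrefl refl l)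
    ... | inj₂ (_ , l) | refl = ⊥-elim (ℕ.<-irrefl refl l)
    FStep-rib-unique s1 s2 | inj₂ (q , refl , eq , _) | inj₁ (a1 , refl , rs1) with RibStep-shape rs1 | anchor-at-root eq
    ... | inj₁ (_ , l) | refl = ⊥-elim (ℕ.<-irrefl refl l)
    ... | inj₂ (_ , l) | refl = ⊥-elim (ℕ.<-irrefl refl l)
    FStep-rib-unique s1 s2 | inj₂ (q1 , refl , eq1 , _) | inj₂ (q2 , refl , eq2 , _) with trans (sym eq1) eq2
    ... | refl = refl

    between-root : ∀ a → Between a root
    between-root a with ℕ.≤-total (toℕ a) (toℕ root)
    ... | inj₁ le = inj₁ (le , ℕ.≤-refl)
    ... | inj₂ le = inj₂ (ℕ.≤-refl , le)

    between-step-middle : ∀ {a a' cc} → RibStep a a' → Between a' cc →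
             (toℕ a ≤ toℕ a' × toℕ a' ≤ toℕ cc) ⊎ (toℕ cc ≤ toℕ a' × toℕ a' ≤ toℕ a)
    between-step-middle rs bt with RibStep-towards-root rs | bt
    ... | inj₁ (l1 , l2) | inj₁ (m1 , m2) = inj₁ (ℕ.<⇒≤ l1 , m1)
    ... | inj₁ (l1 , l2) | inj₂ (m1 , m2) = inj₁ (ℕ.<⇒≤ l1 , ℕ.≤-trans l2 m1)
    ... | inj₂ (l1 , l2) | inj₁ (m1 , m2) = inj₂ (ℕ.≤-trans m2 l1 , ℕ.<⇒≤ l2)
    ... | inj₂ (l1 , l2) | inj₂ (m1 , m2) = inj₂ (m2 , ℕ.<⇒≤ l2)

    rib-⋖C⇒FStep : ∀ {a} (X Y : C) → proj₁ X ≡ rib a → X OC.⋖ Y → FStep (rib a) (proj₁ Y)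
    rib-⋖C⇒FStep (x0 , mx) (y0 , my) refl ((ε , ne) , nb) = ⊥-elim (ne refl)
    rib-⋖C⇒FStep {a} (x0 , mx) (y0 , my) refl ((_◅_ {j = t0} st rest , ne) , nb) with _≟Elem_ t0 y0
    ... | yes refl = st
    ... | no neq = ⊥-elim (nb (t0 , mt) (st ◅ ε , neqA) (rest , neq))
      where
      neqA : ¬ (rib a ≡ t0)
      neqA with FStep-rib-inv st
      ... | inj₁ (a' , refl , rs) = RibStep-irreflexive rs
      ... | inj₂ (q , refl , _) = λ ()
      mt : Mem t0
      mt with FStep-rib-inv st
      ... | inj₂ (q , refl , _ , cv , nf) = mem-up (cv , nf) mx
      ... | inj₁ (a' , refl , rs) = blk-bounds⇒mem-rib (bnd .proj₁) (bnd .proj₂)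
        where
        ya : lo ≤ blockOf y0 × blockOf y0 ≤ hi
        ya = mem⇒blockOf-bounds my
        xa : lo ≤ blk a × blk a ≤ hi
        xa = mem⇒blockOf-bounds mx
        cY : Σ (Fin (suc L)) λ cc → blockOf y0 ≡ blk cc × Between a' cc
        cY with rib-≤F-inv rest
        ... | inj₁ (cc , refl , bt) = cc , refl , bt
        ... | inj₂ (v , refl) = root , refl , between-root a'
        bnd : lo ≤ blk a' × blk a' ≤ hi
        bnd with cY
        ... | cc , eqc , bt with between-step-middle rs bt
        ...   | inj₁ (l1 , l2) = ℕ.≤-trans (proj₁ xa) (blk-mono l1) , ℕ.≤-trans (blk-mono l2) (subst (_≤ hi) eqc (proj₂ ya))
        ...   | inj₂ (l1 , l2) = ℕ.≤-trans (subst (lo ≤_) eqc (proj₁ ya)) (blk-mono l1) , ℕ.≤-trans (blk-mono l2) (proj₂ xa)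

    att-⋖C-inv : ∀ {z t u} (X Y : C) → proj₁ X ≡ att z t u → X OC.⋖ Y →
              (Σ (Fin (size (attP z t))) λ v → proj₁ Y ≡ att z t v) ⊎ proj₁ Y ≡ rib z
    att-⋖C-inv {z} (x0 , mx) (y0 , my) refl ((p , ne) , nb) with att-≤F-inv p
    ... | inj₁ x = inj₁ x
    ... | inj₂ (p1 , p2) with _≟Elem_ (rib z) y0
    ...   | yes eq = inj₂ (sym eq)
    ...   | no neq =
      ⊥-elim (nb (rib z , blk-bounds⇒mem-rib (proj₁ (mem⇒blockOf-bounds mx)) (proj₂ (mem⇒blockOf-bounds mx))) (p1 , λ ()) (p2 , neq))

    module Localize {s e'} (e'≤ : e' ≤ suc s) (g : DK s e' → C) (gE : GC.IsDKEmbedding g) (gConv : OC.Convex (GC.Image g)) where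
      g-⋖ : ∀ a b → Order._⋖_ _≡_ _≤DK_ a b → g a OC.⋖ g b
      g-⋖ = GC.embedding-preserves-⋖ g gE gConv

      cTop⋖dx : g cTop OC.⋖ g dx
      cTop⋖dx = g-⋖ cTop dx (cTop⋖ dx refl)
      cTop⋖dy : g cTop OC.⋖ g dy
      cTop⋖dy = g-⋖ cTop dy (cTop⋖ dy refl)

      dx≢dy : ¬ (proj₁ (g dx) ≡ proj₁ (g dy))
      dx≢dy eq with GC.injective gE dx dy eq
      ... | ()

      g-mono : ∀ a b → a ≤DK b → proj₁ (g a) ≤F proj₁ (g b)
      g-mono a b = proj₁ (GC.order-iff gE a b)

      data Location : Set where
        inAttached : (z : Fin (suc L)) (t : Fin (length (attach z))) →
               (∀ a → Σ (Fin (size (attP z t))) λ w → proj₁ (g a) ≡ att z t w) → Location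
        inAnchored : (∀ a → Σ (Fin qsize) λ w → proj₁ (g a) ≡ anc w) → Location

      upper-cover-in-att : ∀ {z t u} (Xa Xb : C) → proj₁ (g cTop) ≡ att z t u → g cTop OC.⋖ Xa → g cTop OC.⋖ Xb →
              ¬ (proj₁ Xa ≡ proj₁ Xb) → Σ (Fin (size (attP z t))) λ v → proj₁ Xa ≡ att z t v
      upper-cover-in-att {z} {t} {u} Xa Xb eq ca cb ne with att-⋖C-inv (g cTop) Xa eq ca
      ... | inj₁ x = x
      ... | inj₂ xa with att-⋖C-inv (g cTop) Xb eq cb
      ...   | inj₂ xb = ⊥-elim (ne (trans xa (sym xb)))
      ...   | inj₁ (yv , yb) = ⊥-elim (¬¬att≤F-rib yv λ le →
               proj₂ ca Xb (proj₁ cb) (subst₂ _≤F_ (sym yb) (sym xa) le , λ e → ar (trans (sym yb) (trans e xa))))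
        where
        ar : ¬ (att z t yv ≡ rib z)
        ar ()

      module InAttached (z : Fin (suc L)) (t : Fin (length (attach z))) (u : Fin (size (attP z t)))
                   (eq0 : proj₁ (g cTop) ≡ att z t u) where
        InA : C → Set
        InA X = Σ (Fin (size (attP z t))) λ w → proj₁ X ≡ att z t w

        xA : InA (g dx)
        xA = upper-cover-in-att (g dx) (g dy) eq0 cTop⋖dx cTop⋖dy dx≢dy
        yA : InA (g dy)
        yA = upper-cover-in-att (g dy) (g dx) eq0 cTop⋖dy cTop⋖dx (λ e → dx≢dy (sym e))

        cA : ∀ j → InA (g (c j))
        cA j = let (w , eq , _) = ≤F-att-inv (subst (proj₁ (g (c j)) ≤F_) eq0 (g-mono (c j) cTop (c≤DK-cTop j))) in w , eq

        -- nk i covers the top of the copy of d^- spanned by c, dx, dy and the neck below it; that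
        -- copy has an upper cover inside the attached poset, which lies strictly below rib z.
        module NeckStep (k : ℕ) (i : Fin e') (ik : toℕ i ≡ k) (IH : ∀ (i' : Fin e') → toℕ i' < k → InA (g (nk i'))) where
          k≤s : k ≤ s
          k≤s = subst (_≤ s) ik (ℕ.≤-pred (ℕ.<-≤-trans (Fin.toℕ<n i) e'≤))
          k≤e' : k ≤ e'
          k≤e' = subst (_≤ e') ik (ℕ.<⇒≤ (Fin.toℕ<n i))
          module E = Restriction {s} {e'} {k} k≤s k≤e'
          inP2 : ∀ α → InA (g (E.restrict α))
          inP2 (c j) = cA _
          inP2 dx = xA
          inP2 dy = yA
          inP2 (nk j) = IH _ (subst (_< k) (sym (Fin.toℕ-fromℕ< (E.nk-bound j))) (Fin.toℕ<n j))
          rankEq : suc (rank (E.restrict (dk⁻Top {k}))) ≡ rank (nk {s} {e'} i)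
          rankEq = begin
              suc (rank (E.restrict dk⁻Top))
            ≡⟨ cong suc (E.rank-restrict dk⁻Top) ⟩
              suc (rank (dk⁻Top {k}) + (s ∸ k))
            ≡⟨ cong (λ x → suc (x + (s ∸ k))) (rank-dk⁻Top k) ⟩
              suc (suc (k + k) + (s ∸ k))
            ≡⟨ cong (λ x → suc (suc x)) (ℕ.+-assoc k k (s ∸ k)) ⟩
              suc (suc (k + (k + (s ∸ k))))
            ≡⟨ cong (λ x → suc (suc (k + x))) (ℕ.m+[n∸m]≡n k≤s) ⟩
              suc (suc (k + s))
            ≡⟨ cong (λ x → suc (suc x)) (ℕ.+-comm k s) ⟩
              suc (suc (s + k))
            ≡⟨ cong (λ x → suc (suc (s + x))) (sym ik) ⟩
              rank (nk {s} {e'} i)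
            ∎
            where open ≡-Reasoning
          cv : g (E.restrict dk⁻Top) OC.⋖ g (nk i)
          cv = g-⋖ _ _ (rank-suc⇒⋖ _ _ rankEq)
          TA = Transfer.CoverAboveTop.cover (attachedPiece z t) (g ∘ E.restrict)
                 (GC.restrict-embedding k≤s k≤e' gE) (GC.restrict-image-convex k≤s k≤e' gE gConv) inP2
          ar : ∀ {pc} → ¬ (att z t pc ≡ rib z)
          ar ()
          res : InA (g (nk i))
          res with att-⋖C-inv (g (E.restrict dk⁻Top)) (g (nk i)) (proj₂ (inP2 dk⁻Top)) cv
          ... | inj₁ x = x
          ... | inj₂ eqz =
            let (p , (le , ne) , pc , peq) = TA in
            ⊥-elim (¬¬att≤F-rib pc λ le2 →
              proj₂ cv p (le , ne) (subst₂ _≤F_ (sym peq) (sym eqz) le2 , λ e → ar (trans (sym peq) (trans e eqz))))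

        neckStep : ∀ k (i : Fin e') → toℕ i ≡ k → (∀ (i' : Fin e') → toℕ i' < k → InA (g (nk i'))) → InA (g (nk i))
        neckStep k i ik IH = NeckStep.res k i ik IH

        neck : ∀ k (i : Fin e') → toℕ i < k → InA (g (nk i))
        neck zero i ()
        neck (suc k) i lt with toℕ i ℕ.<? k
        ... | yes lt' = neck k i lt'
        ... | no nlt = neckStep k i (ℕ.≤-antisym (ℕ.≤-pred lt) (ℕ.≮⇒≥ nlt)) (neck k)

        allA : ∀ a → InA (g a)
        allA (c j) = cA j
        allA dx = xA
        allA dy = yA
        allA (nk i) = neck (suc (toℕ i)) i (ℕ.n<1+n _)

      -- Leaving Q downwards from cTop passes the anchor q ≤ cTop; as q is in the top tree,
      -- cTop would then have a unique upper cover, but dx and dy are two.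
      module InAnchored (u : Fin qsize) (eq0 : proj₁ (g cTop) ≡ anc u) where
        allQ : ∀ a → Σ (Fin qsize) λ w → proj₁ (g a) ≡ anc w
        allQ a with cTop-comparable a
        ... | inj₁ le = let (v , eq , _) = anc-≤F-inv (subst (_≤F proj₁ (g a)) eq0 (g-mono cTop a le)) in v , eq
        ... | inj₂ le with ≤F-anc-inv (subst (proj₁ (g a) ≤F_) eq0 (g-mono a cTop le))
        ...   | inj₁ (w , eq , _) = w , eq
        ...   | inj₂ (j , q , _ , _ , eqa , qu) =
          let (xa , eqx , _) = anc-≤F-inv (subst (_≤F proj₁ (g dx)) eq0 (g-mono cTop dx (inj₂ (s≤s (ℕ.≤-reflexive (Fin.toℕ-fromℕ s))))))
              (ya , eqy , _) = anc-≤F-inv (subst (_≤F proj₁ (g dy)) eq0 (g-mono cTop dy (inj₂ (s≤s (ℕ.≤-reflexive (Fin.toℕ-fromℕ s))))))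
              cvx = Transfer.⋖C⇒⋖ anchoredPiece (g cTop) (g dx) u xa eq0 eqx cTop⋖dx
              cvy = Transfer.⋖C⇒⋖ anchoredPiece (g cTop) (g dy) u ya eq0 eqy cTop⋖dy
              xaya = proj₁ (anchor-acyclic eqa) u qu xa ya cvx cvy
          in ⊥-elim (dx≢dy (trans eqx (trans (cong anc xaya) (sym eqy))))

      located : Location
      located with proj₁ (g cTop) in eq0
      ... | rib a = ⊥-elim (dx≢dy (FStep-rib-unique (rib-⋖C⇒FStep (g cTop) (g dx) eq0 cTop⋖dx) (rib-⋖C⇒FStep (g cTop) (g dy) eq0 cTop⋖dy)))
      ... | att z t u = inAttached z t (InAttached.allA z t u eq0)
      ... | anc u = inAnchored (InAnchored.allQ u eq0)


    condition₁ : ∀ m (I : C → Set) → OC.DkMinusConvex m I → CoverCompletion {m} I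
    condition₁ m I (cv , order-iff) with GC.isoOnto⇒embedding I order-iff
    ... | (f , fE , im) with Localize.located (ℕ.n≤1+n m) f fE (GC.image-convex I f im cv)
    ...   | Localize.inAttached z t inP = Transfer.Condition₁.holds (attachedPiece z t) I f fE im (GC.image-convex I f im cv) inP
    ...   | Localize.inAnchored inP = Transfer.Condition₁.holds anchoredPiece I f fE im (GC.image-convex I f im cv) inP

    module TopOfInterval {m} (w z : C) (h : DK m (suc m) → C) (him : ∀ u → OC.Interval w z u iff GC.Image h u) where
      ivc = proj₂ (him (h (c fzero))) (c fzero , refl)
      ivz : OC.Interval w z z
      ivz = IsPartialOrder.trans ≤F-isPartialOrder (proj₁ ivc) (proj₂ ivc) , ε
      az = proj₁ (proj₁ (him z) ivz)
      zeq0 : proj₁ (h az) ≡ proj₁ z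
      zeq0 = proj₂ (proj₁ (him z) ivz)

    -- A lower cover of z from outside Q reaches z through the anchor q: q = z puts q in a
    -- neck, and q < z contradicts the cover.
    module Condition₂Anchored {m} (w z : C) (h : DK m (suc m) → C) (hE : GC.IsDKEmbedding h) (him : ∀ u → OC.Interval w z u iff GC.Image h u)
               (inP : ∀ a → Σ (Fin qsize) λ w' → proj₁ (h a) ≡ anc w') (u : C) (ucov : u OC.⋖ z) where
      open TopOfInterval w z h him
      zv = proj₁ (inP az)
      zeq : proj₁ z ≡ anc zv
      zeq = trans (sym zeq0) (proj₂ (inP az))
      module C2 = Transfer.Condition₂ anchoredPiece w z h hE him inP
      holds : OC.Interval w z u
      holds with ≤F-anc-inv (subst (proj₁ u ≤F_) zeq (proj₁ (proj₁ ucov)))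
      ... | inj₁ (uv , ueq , _) = C2.holds u ucov (uv , ueq)
      ... | inj₂ (j , q , p , cvq , eqa , qzv) with _≟Elem_ (anc q) (proj₁ z)
      ...   | yes eqq = ⊥-elim (proj₂ (anchor-acyclic eqa) (m , C2.w'' , C2.z'' , C2.dk' , fromℕ m , anc-injective (trans C2.ez (sym eqq))))
      ...   | no neq = ⊥-elim (Transfer.¬¬ι-mono anchoredPiece qzv λ le →
                 proj₂ ucov (anc q , mq) (p ◅◅ (inj₁ cvq ◅ ε) , unq) (subst (anc q ≤F_) (sym zeq) le , neq))
        where
        zc : lo ≤ blk root × blk root ≤ hi
        zc = subst (λ x → lo ≤ blockOf x × blockOf x ≤ hi) zeq (mem⇒blockOf-bounds (proj₂ z))
        mj : Mem (rib j)
        mj = blk-bounds⇒mem-rib (subst (lo ≤_) (cong blk (sym (anchor-at-root eqa))) (proj₁ zc))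
                                (subst (_≤ hi) (cong blk (sym (anchor-at-root eqa))) (proj₂ zc))
        mq : Mem (anc q)
        mq = mem-up cvq mj
        unq : ¬ (proj₁ u ≡ anc q)
        unq e with anc-≤F-inv (subst (_≤F rib j) e p)
        ... | _ , () , _

    condition₂ : ∀ m w z → OC.DkInterval m w z → ∀ u → u OC.⋖ z → OC.Interval w z u
    condition₂ m w z order-iff u ucov with GC.isoOnto⇒embedding (OC.Interval w z) order-iff
    ... | (h , hE , him)
        with Localize.located ℕ.≤-refl h hE (GC.image-convex _ h him (interval-convex _≈C_ (IsPartialOrder.trans ≤F-isPartialOrder) w z))
    ...   | Localize.inAttached z' t inP = Transfer.Condition₂.holds (attachedPiece z' t) w z h hE him inP u ucov uA
      where
      open TopOfInterval w z h him
      zeq : proj₁ z ≡ att z' t (proj₁ (inP az))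
      zeq = trans (sym zeq0) (proj₂ (inP az))
      uA = let (w' , e' , _) = ≤F-att-inv (subst (proj₁ u ≤F_) zeq (proj₁ (proj₁ ucov))) in w' , e'
    ...   | Localize.inAnchored inP = Condition₂Anchored.holds w z h hE him inP u ucov

    samePiece : ∀ {z t z' t'} {w1 : Fin (size (attP z' t'))} {w2 : Fin (size (attP z t))}
                (P : (z1 : Fin (suc L)) (t1 : Fin (length (attach z1))) → Set) → att z' t' w1 ≡ att z t w2 → P z' t' → P z t
    samePiece P refl x = x

    module Condition₃Proof (m : ℕ) (I J : C → Set) (dI : OC.DkMinusConvex m I) (dJ : OC.DkMinusConvex m J)
              (H : ∀ u → (I u × ¬ OC.MinIn I u) iff (J u × ¬ OC.MinIn J u)) where
      fI = GC.isoOnto⇒embedding I (proj₂ dI)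
      f = proj₁ fI
      fE = proj₁ (proj₂ fI)
      imI = proj₂ (proj₂ fI)
      fConv = GC.image-convex I f imI (proj₁ dI)
      kJ = GC.isoOnto⇒embedding J (proj₂ dJ)
      k' = proj₁ kJ
      kE = proj₁ (proj₂ kJ)
      imJ = proj₂ (proj₂ kJ)
      kConv = GC.image-convex J k' imJ (proj₁ dJ)

      notMin : ¬ OC.MinIn I (f dx)
      notMin (_ , mn) with GC.injective fE _ _ (mn (f (c fzero)) (proj₂ (imI (f (c fzero))) (c fzero , refl))
                                           (proj₁ (GC.order-iff fE (c fzero) dx) (c0-≤DK dx)))
      ... | ()

      jx : J (f dx)
      jx = proj₁ (proj₁ (H (f dx)) (proj₂ (imI (f dx)) (dx , refl) , notMin))
      b = proj₁ (proj₁ (imJ (f dx)) jx)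
      kb : proj₁ (k' b) ≡ proj₁ (f dx)
      kb = proj₂ (proj₁ (imJ (f dx)) jx)

      holds : ∀ u → I u iff J u
      holds with Localize.located (ℕ.n≤1+n m) f fE fConv | Localize.located (ℕ.n≤1+n m) k' kE kConv
      ... | Localize.inAttached z t inPI | Localize.inAttached z' t' inPJ =
        Transfer.Condition₃.holds (attachedPiece z t) I J f k' fE kE imI imJ fConv kConv inPI
          (samePiece (λ z1 t1 → ∀ a → Σ (Fin (size (attP z1 t1))) λ w → proj₁ (k' a) ≡ att z1 t1 w)
                     (trans (sym (proj₂ (inPJ b))) (trans kb (proj₂ (inPI dx)))) inPJ) H
      holds | Localize.inAnchored inPI | Localize.inAnchored inPJ =
        Transfer.Condition₃.holds anchoredPiece I J f k' fE kE imI imJ fConv kConv inPI inPJ H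
      holds | Localize.inAttached z t inPI | Localize.inAnchored inPJ with trans (sym (proj₂ (inPJ b))) (trans kb (proj₂ (inPI dx)))
      ... | ()
      holds | Localize.inAnchored inPI | Localize.inAttached z t inPJ with trans (sym (proj₂ (inPJ b))) (trans kb (proj₂ (inPI dx)))
      ... | ()

    isDComplete : Order.IsDCompletePoset _≈C_ _≤C_
    isDComplete = isPartialOrder-C , condition₁ , condition₂ , (λ m I J dI dJ H → Condition₃Proof.holds m I J dI dJ H)

-- A free-standing mobile has an empty Q, whose order Defs fixes as the constant relation Bool.
empty-isPartialOrder : IsPartialOrder {A = Fin 0} _≡_ (λ _ _ → Bool)
empty-isPartialOrder = record
  { isPreorder = record { isEquivalence = isEquivalence ; reflexive = λ _ → true ; trans = λ _ _ → true }
  ; antisym = λ { {()} } }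

empty-dComplete : Order.DComplete {Fin 0} _≡_ (λ _ _ → Bool)
empty-dComplete = (λ m I I-dk⁻ → case proj₁ (proj₂ I-dk⁻) (c fzero) of λ ()) , (λ { m () }) , (λ { m I J _ _ _ () })

empty-connected : Order.Connected {Fin 0} _≡_ (λ _ _ → Bool)
empty-connected ()

free-oriented : ∀ L S attach → OrientedTowards (record { L = L ; S = S ; attach = attach ; anch = free }) (fromℕ L)
free-oriented L S attach b =
  (λ _ → subst (suc (toℕ b) ≤_) (sym (Fin.toℕ-fromℕ L)) (Fin.toℕ<n b)) , (λ ¬up → ⊥-elim (¬up (always-up (S b))))
  where
  always-up : ∀ x → T (if x then x else not x)
  always-up true = tt
  always-up false = tt

anchored-oriented : ∀ L S attach j Q q (acyclic : Order.Acyclic _≡_ (_≤ₚ_ Q) q) →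
  OrientedTowards (record { L = L ; S = S ; attach = attach ; anch = anchored j Q q acyclic }) j
anchored-oriented L S attach j Q q _ b with S b | toℕ b <ᵇ toℕ j in b<ᵇj
... | true | true = (λ _ → ℕ.<ᵇ⇒< (toℕ b) (toℕ j) (subst T (sym b<ᵇj) tt)) , (λ ¬up → ⊥-elim (¬up tt))
... | false | true = (λ _ → ℕ.<ᵇ⇒< (toℕ b) (toℕ j) (subst T (sym b<ᵇj) tt)) , (λ ¬up → ⊥-elim (¬up tt))
... | true | false = (λ ()) , (λ _ → ℕ.≮⇒≥ (λ lt → subst T b<ᵇj (ℕ.<⇒<ᵇ lt)))
... | false | false = (λ ()) , (λ _ → ℕ.≮⇒≥ (λ lt → subst T b<ᵇj (ℕ.<⇒<ᵇ lt)))

lemma4p8 : (M : Mobile) (i j : ℕ) → i ≤ j → j ≤ MobileP.k M →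
    Order.IsDCompletePoset (MobileP._≈ij_ M {i} {j}) (MobileP._≤ij_ M {i} {j})
lemma4p8 M@(record { L = L ; S = S ; attach = attach ; anch = free }) i j _ _ =
  FoldedMobile.Pij.isDComplete M (fromℕ L) empty-isPartialOrder empty-dComplete empty-connected
    (λ ()) (λ ()) (free-oriented L S attach) i j
lemma4p8 M@(record { L = L ; S = S ; attach = attach ; anch = anchored root Q q acyclic }) i j _ _ =
  FoldedMobile.Pij.isDComplete M root (isPO Q) (dcomp Q) (conn Q)
    (λ { refl → refl }) (λ { refl → acyclic }) (anchored-oriented L S attach root Q q acyclic) i j
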